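{- $\mathcal{T}(5) = 10$ and $\mathcal{T}(6) = 13$.
   Context: A code $\mathcal{C} \subseteq \{0,1,2\}^n$ is called trifferent with length $n$ if for any three distinct elements of $\mathcal{C}$ there exists a coordinate in which they all differ (i.e., the three elements take the three distinct values $0,1,2$ in that coordinate). $\mathcal{T}(n)$ denotes the maximum cardinality of a trifferent code with length $n$. -}

module Defs where

open import Data.Nat using (ℕ; _≤_)
open import Data.Fin using (Fin)
open import Data.Vec using (Vec; lookup)
open import Data.List using (List; length)
open import Data.List.Membership.Propositional using (_∈_)
open import Data.List.Relation.Unary.Unique.Propositional using (Unique)
open import Data.Product using (Σ; ∃; _×_)
open import Relation.Binary.PropositionalEquality using (_≡_; _≢_)

Word : ℕ → Set
Word n = Vec (Fin 3) n

-- A code is a finite set of words, represented as a duplicate-free list.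
-- Trifferent: any three distinct codewords have a coordinate where they all differ.
Trifferent : {n : ℕ} → List (Word n) → Set
Trifferent {n} C =
  ∀ x y z → x ∈ C → y ∈ C → z ∈ C →
  x ≢ y → y ≢ z → x ≢ z →
  ∃ λ (i : Fin n) →
    (lookup x i ≢ lookup y i) × (lookup y i ≢ lookup z i) × (lookup x i ≢ lookup z i)

-- 𝒯 n ≡ m, stated relationally: m is the maximum cardinality of a
-- trifferent code of length n (attained, and an upper bound for all codes).
IsMaxTrifferentSize : ℕ → ℕ → Set
IsMaxTrifferentSize n m =
  (Σ (List (Word n)) λ C → Unique C × Trifferent C × length C ≡ m)
  × (∀ (C : List (Word n)) → Unique C → Trifferent C → length C ≤ m)

-- Among the codewords of a trifferent code of length n + 1 and size k, those whose first symbol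
-- avoids a suitable a ∈ {0,1,2} number at least 2k/3, and deleting their first coordinate gives a
-- trifferent code of length n: three distinct first symbols would have to include a.  So once the
-- trifferent codes of length n and size ⌈2k/3⌉ are classified, up to permutations of the
-- coordinates and of the symbols in each coordinate, by small representative subcodes, every code
-- of length n + 1 and size k can be normalised to contain, for each word r of some representative,
-- one of 1r and 2r.  An exhaustive backtracking search over such codes, with a symmetry
-- certificate for each leaf, then classifies length n + 1.  Starting from size 4 in length 2 this
-- classifies sizes 5, 7 and 10 in lengths 3, 4 and 5, and shows that there is no code of size 11
-- in length 5 nor of size 14 in length 6; explicit codes of sizes 10 and 13 attain the bounds.
module Submission where

open import Defs
open import Data.Empty using (⊥; ⊥-elim)
open import Data.Fin using (Fin; suc; punchOut)
open import Data.Fin.Patterns using (0F; 1F; 2F; 3F; 4F)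
open import Data.Fin.Properties using (punchOut-injective)
  renaming (_≟_ to _≟ᶠ_; any? to anyᶠ?; all? to allᶠ?)
open import Data.List using (List; []; _∷_; length; map; filter; _++_)
open import Data.List.Properties using (length-++; length-map; map-∘)
open import Data.List.Membership.Propositional using (_∈_; _∉_; find; lose)
import Data.List.Membership.DecPropositional as ∈-Dec
open import Data.List.Membership.Propositional.Properties
  using (∈-filter⁺; ∈-filter⁻; ∈-map⁺; ∈-map⁻; ∈-++⁺ˡ; ∈-++⁺ʳ; ∈-++⁻; ∈-∃++)
open import Data.List.Relation.Binary.Subset.Propositional using (_⊆_)
import Data.List.Relation.Binary.Subset.DecPropositional as ⊆-Dec
open import Data.List.Relation.Binary.Subset.Propositional.Properties using (⊆-trans)
  renaming (map⁺ to ⊆-map⁺)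
open import Data.List.Relation.Unary.All as All using (All; []; _∷_)
import Data.List.Relation.Unary.All.Properties as All
open import Data.List.Relation.Unary.AllPairs using ([]; _∷_)
open import Data.List.Relation.Unary.Any as Any using (Any; here; there)
open import Data.List.Relation.Unary.Unique.Propositional using (Unique)
import Data.List.Relation.Unary.Unique.Propositional.Properties as Unique
import Data.List.Relation.Unary.Unique.DecPropositional as Unique-Dec
open import Data.Maybe using (Maybe; just; nothing; _>>=_)
open import Data.Nat using (ℕ; zero; suc; _+_; _*_; _≤_; _<_; z≤n; s≤s; _≤?_; _<?_)
open import Data.Nat.Properties
  using (≤-trans; ≤-pred; <⇒≱; ≰⇒>; <-irrefl; +-suc; *-suc; +-mono-≤; +-monoʳ-≤;
         +-monoʳ-<; *-monoʳ-≤; module ≤-Reasoning)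
open import Data.Nat.Tactic.RingSolver using (solve-∀)
open import Data.Product using (∃; ∃₂; _×_; _,_; proj₂)
import Data.Product as Product
open import Data.Sum using (_⊎_; inj₁; inj₂; [_,_]′)
import Data.Sum as Sum
open import Data.Vec using (Vec; []; _∷_; lookup; tabulate; head; tail)
open import Data.Vec.Properties
  using (≡-dec; ∷-injectiveˡ; ∷-injectiveʳ; lookup∘tabulate; tabulate∘lookup; tabulate-cong)
open import Function using (id; _∘_)
open import Relation.Binary.Definitions using (DecidableEquality)
open import Relation.Binary.PropositionalEquality
open import Relation.Nullary using (Dec; yes; no)
open import Relation.Nullary.Decidable
  using (True; toWitness; from-yes; map′; ¬?; _×-dec_; _⊎-dec_; _→-dec_)

module _ {A : Set} where

  unique-⊆⇒length≤ : ∀ {xs ys : List A} → Unique xs → xs ⊆ ys → length xs ≤ length ys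
  unique-⊆⇒length≤ {[]} _ _ = z≤n
  unique-⊆⇒length≤ {x ∷ xs} (x∉xs ∷ u) xs⊆ys
    with ys₁ , ys₂ , refl ← ∈-∃++ (xs⊆ys (here refl)) = begin
      suc (length xs)               ≤⟨ s≤s (unique-⊆⇒length≤ u xs⊆ys₁++ys₂) ⟩
      suc (length (ys₁ ++ ys₂))     ≡⟨ cong suc (length-++ ys₁) ⟩
      suc (length ys₁ + length ys₂) ≡⟨ +-suc (length ys₁) (length ys₂) ⟨
      length ys₁ + length (x ∷ ys₂) ≡⟨ length-++ ys₁ ⟨
      length (ys₁ ++ x ∷ ys₂)       ∎
    where
    open ≤-Reasoning
    xs⊆ys₁++ys₂ : xs ⊆ ys₁ ++ ys₂
    xs⊆ys₁++ys₂ z∈xs with ∈-++⁻ ys₁ (xs⊆ys (there z∈xs))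
    ... | inj₁ z∈ys₁         = ∈-++⁺ˡ z∈ys₁
    ... | inj₂ (here refl)   = ⊥-elim (All.lookup x∉xs z∈xs refl)
    ... | inj₂ (there z∈ys₂) = ∈-++⁺ʳ ys₁ z∈ys₂

  unique-map⁺ : ∀ {B : Set} (f : A → B) {xs} →
                (∀ {x y} → x ∈ xs → y ∈ xs → x ≢ y → f x ≢ f y) → Unique xs → Unique (map f xs)
  unique-map⁺ f {[]} _ [] = []
  unique-map⁺ f {x ∷ xs} f-inj (x∉xs ∷ u) =
    All.map⁺ (All.tabulate λ y∈xs → f-inj (here refl) (there y∈xs) (All.lookup x∉xs y∈xs))
    ∷ unique-map⁺ f (λ x∈ y∈ → f-inj (there x∈) (there y∈)) u

  third-element : DecidableEquality A → ∀ {xs} (x y : A) → Unique xs → 3 ≤ length xs →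
                  ∃ λ z → z ∈ xs × z ≢ x × z ≢ y
  third-element _≟_ {xs} x y u 3≤∣xs∣ with Any.any? (λ z → ¬? (z ≟ x) ×-dec ¬? (z ≟ y)) xs
  ... | yes other = find other
  ... | no ¬other = ⊥-elim (<⇒≱ 3≤∣xs∣ (unique-⊆⇒length≤ u xs⊆xy))
    where
    xs⊆xy : xs ⊆ x ∷ y ∷ []
    xs⊆xy {z} z∈xs with z ≟ x | z ≟ y
    ... | yes refl | _       = here refl
    ... | no _     | yes refl = there (here refl)
    ... | no z≢x   | no z≢y   = ⊥-elim (¬other (lose z∈xs (z≢x , z≢y)))

>>=-just : ∀ {A B : Set} (m : Maybe A) {k : A → Maybe B} {b} →
           (m >>= k) ≡ just b → ∃ λ a → m ≡ just a × k a ≡ just b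
>>=-just (just a) eq = a , refl , eq

-- πabc sends 0, 1, 2 to a, b, c.
data Perm₃ : Set where
  π012 π021 π102 π120 π201 π210 : Perm₃

⟦_⟧ : Perm₃ → Fin 3 → Fin 3
⟦ π012 ⟧ a  = a
⟦ π021 ⟧ 0F = 0F
⟦ π021 ⟧ 1F = 2F
⟦ π021 ⟧ 2F = 1F
⟦ π102 ⟧ 0F = 1F
⟦ π102 ⟧ 1F = 0F
⟦ π102 ⟧ 2F = 2F
⟦ π120 ⟧ 0F = 1F
⟦ π120 ⟧ 1F = 2F
⟦ π120 ⟧ 2F = 0F
⟦ π201 ⟧ 0F = 2F
⟦ π201 ⟧ 1F = 0F
⟦ π201 ⟧ 2F = 1F
⟦ π210 ⟧ 0F = 2F
⟦ π210 ⟧ 1F = 1F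
⟦ π210 ⟧ 2F = 0F

_⁻¹ : Perm₃ → Perm₃
π012 ⁻¹ = π012
π021 ⁻¹ = π021
π102 ⁻¹ = π102
π120 ⁻¹ = π201
π201 ⁻¹ = π120
π210 ⁻¹ = π210

⟦⟧-inverseˡ : ∀ p a → ⟦ p ⁻¹ ⟧ (⟦ p ⟧ a) ≡ a
⟦⟧-inverseˡ π012 a  = refl
⟦⟧-inverseˡ π021 0F = refl
⟦⟧-inverseˡ π021 1F = refl
⟦⟧-inverseˡ π021 2F = refl
⟦⟧-inverseˡ π102 0F = refl
⟦⟧-inverseˡ π102 1F = refl
⟦⟧-inverseˡ π102 2F = refl
⟦⟧-inverseˡ π120 0F = refl
⟦⟧-inverseˡ π120 1F = refl
⟦⟧-inverseˡ π120 2F = refl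
⟦⟧-inverseˡ π201 0F = refl
⟦⟧-inverseˡ π201 1F = refl
⟦⟧-inverseˡ π201 2F = refl
⟦⟧-inverseˡ π210 0F = refl
⟦⟧-inverseˡ π210 1F = refl
⟦⟧-inverseˡ π210 2F = refl

⟦⟧-injective : ∀ p {a b} → ⟦ p ⟧ a ≡ ⟦ p ⟧ b → a ≡ b
⟦⟧-injective p {a} {b} eq = begin
  a                   ≡⟨ ⟦⟧-inverseˡ p a ⟨
  ⟦ p ⁻¹ ⟧ (⟦ p ⟧ a) ≡⟨ cong ⟦ p ⁻¹ ⟧ eq ⟩
  ⟦ p ⁻¹ ⟧ (⟦ p ⟧ b) ≡⟨ ⟦⟧-inverseˡ p b ⟩
  b                   ∎
  where open ≡-Reasoning

sendTo0 : Fin 3 → Perm₃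
sendTo0 0F = π012
sendTo0 1F = π102
sendTo0 2F = π210

sendTo0-sends : ∀ a → ⟦ sendTo0 a ⟧ a ≡ 0F
sendTo0-sends 0F = refl
sendTo0-sends 1F = refl
sendTo0-sends 2F = refl

sendTo0-others : ∀ a {b} → b ≢ a → ⟦ sendTo0 a ⟧ b ≡ 1F ⊎ ⟦ sendTo0 a ⟧ b ≡ 2F
sendTo0-others a {b} b≢a =
  nonzero λ eq → b≢a (⟦⟧-injective (sendTo0 a) (trans eq (sym (sendTo0-sends a))))
  where
  nonzero : ∀ {c : Fin 3} → c ≢ 0F → c ≡ 1F ⊎ c ≡ 2F
  nonzero {0F} c≢0 = ⊥-elim (c≢0 refl)
  nonzero {1F} _   = inj₁ refl
  nonzero {2F} _   = inj₂ refl

collision₂ : ∀ (u v w : Fin 2) → u ≡ v ⊎ v ≡ w ⊎ u ≡ w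
collision₂ 0F 0F _  = inj₁ refl
collision₂ 1F 1F _  = inj₁ refl
collision₂ 0F 1F 0F = inj₂ (inj₂ refl)
collision₂ 0F 1F 1F = inj₂ (inj₁ refl)
collision₂ 1F 0F 0F = inj₂ (inj₁ refl)
collision₂ 1F 0F 1F = inj₂ (inj₂ refl)

collision₃-avoiding : ∀ {a b c d : Fin 3} → b ≢ a → c ≢ a → d ≢ a → b ≡ c ⊎ c ≡ d ⊎ b ≡ d
collision₃-avoiding b≢a c≢a d≢a =
  Sum.map (punchOut-injective a≢b a≢c) (Sum.map (punchOut-injective a≢c a≢d) (punchOut-injective a≢b a≢d))
          (collision₂ (punchOut a≢b) (punchOut a≢c) (punchOut a≢d))
  where
  a≢b = ≢-sym b≢a
  a≢c = ≢-sym c≢a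
  a≢d = ≢-sym d≢a

_≟ʷ_ : ∀ {n} → DecidableEquality (Word n)
_≟ʷ_ = ≡-dec _≟ᶠ_

_∈ʷ?_ : ∀ {n} (x : Word n) (xs : List (Word n)) → Dec (x ∈ xs)
_∈ʷ?_ = ∈-Dec._∈?_ _≟ʷ_

_⊆ʷ?_ : ∀ {n} (xs ys : List (Word n)) → Dec (xs ⊆ ys)
_⊆ʷ?_ = ⊆-Dec._⊆?_ _≟ʷ_

unique? : ∀ {n} (C : List (Word n)) → Dec (Unique C)
unique? = Unique-Dec.unique? _≟ʷ_

Separates : ∀ {n} → Word n → Word n → Word n → Fin n → Set
Separates x y z i = lookup x i ≢ lookup y i × lookup y i ≢ lookup z i × lookup x i ≢ lookup z i

Separated : ∀ {n} → Word n → Word n → Word n → Set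
Separated x y z = ∃ (Separates x y z)

separated? : ∀ {n} (x y z : Word n) → Dec (Separated x y z)
separated? []      []      []      = no λ ()
separated? (a ∷ x) (b ∷ y) (c ∷ z) =
  map′ [ (0F ,_) , Product.map suc id ]′ split
       ((¬? (a ≟ᶠ b) ×-dec ¬? (b ≟ᶠ c) ×-dec ¬? (a ≟ᶠ c)) ⊎-dec separated? x y z)
  where
  split : Separated (a ∷ x) (b ∷ y) (c ∷ z) → _ ⊎ Separated x y z
  split (0F , s)    = inj₁ s
  split (suc i , s) = inj₂ (i , s)

trifferent? : ∀ {n} (C : List (Word n)) → Dec (Trifferent C)
trifferent? C = map′
  (λ t x y z x∈ y∈ z∈ → All.lookup (All.lookup (All.lookup t x∈) y∈) z∈)
  (λ t → All.tabulate λ x∈ → All.tabulate λ y∈ → All.tabulate λ z∈ → t _ _ _ x∈ y∈ z∈)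
  (All.all? (λ x → All.all? (λ y → All.all? (λ z →
     ¬? (x ≟ʷ y) →-dec ¬? (y ≟ʷ z) →-dec ¬? (x ≟ʷ z) →-dec separated? x y z) C) C) C)

allWords : ∀ n → List (Word n)
allWords zero    = [] ∷ []
allWords (suc n) = map (0F ∷_) (allWords n) ++ map (1F ∷_) (allWords n) ++ map (2F ∷_) (allWords n)

∈-allWords : ∀ {n} (x : Word n) → x ∈ allWords n
∈-allWords []       = here refl
∈-allWords {suc n} (0F ∷ x) = ∈-++⁺ˡ (∈-map⁺ (0F ∷_) (∈-allWords x))
∈-allWords {suc n} (1F ∷ x) = ∈-++⁺ʳ (map (0F ∷_) (allWords n)) (∈-++⁺ˡ (∈-map⁺ (1F ∷_) (∈-allWords x)))
∈-allWords {suc n} (2F ∷ x) =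
  ∈-++⁺ʳ (map (0F ∷_) (allWords n)) (∈-++⁺ʳ (map (1F ∷_) (allWords n)) (∈-map⁺ (2F ∷_) (∈-allWords x)))

record IsSymmetry {n} (f : Word n → Word n) : Set where
  field
    injective : ∀ {x y} → f x ≡ f y → x ≡ y
    separated : ∀ x y z → Separated x y z → Separated (f x) (f y) (f z)

open IsSymmetry

id-IsSymmetry : ∀ {n} → IsSymmetry {n} id
id-IsSymmetry = record { injective = id ; separated = λ _ _ _ → id }

∘-IsSymmetry : ∀ {n} {f g : Word n → Word n} → IsSymmetry f → IsSymmetry g → IsSymmetry (f ∘ g)
∘-IsSymmetry {g = g} f-sym g-sym = record
  { injective = injective g-sym ∘ injective f-sym
  ; separated = λ x y z → separated f-sym (g x) (g y) (g z) ∘ separated g-sym x y z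
  }

map-Unique : ∀ {n} {f : Word n → Word n} {C} → IsSymmetry f → Unique C → Unique (map f C)
map-Unique f-sym = Unique.map⁺ (injective f-sym)

map-Trifferent : ∀ {n} {f : Word n → Word n} {C} → IsSymmetry f → Trifferent C → Trifferent (map f C)
map-Trifferent {f = f} f-sym tri _ _ _ fx∈ fy∈ fz∈ fx≢fy fy≢fz fx≢fz
  with x , x∈ , refl ← ∈-map⁻ f fx∈
     | y , y∈ , refl ← ∈-map⁻ f fy∈
     | z , z∈ , refl ← ∈-map⁻ f fz∈
  = separated f-sym x y z (tri x y z x∈ y∈ z∈ (fx≢fy ∘ cong f) (fy≢fz ∘ cong f) (fx≢fz ∘ cong f))

liftWith : ∀ {n} → Perm₃ → (Word n → Word n) → Word (suc n) → Word (suc n)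
liftWith p f (a ∷ x) = ⟦ p ⟧ a ∷ f x

liftWith-IsSymmetry : ∀ {n} p {f : Word n → Word n} → IsSymmetry f → IsSymmetry (liftWith p f)
liftWith-IsSymmetry p f-sym = record { injective = inj ; separated = sep }
  where
  inj : ∀ {x y} → liftWith p _ x ≡ liftWith p _ y → x ≡ y
  inj {_ ∷ _} {_ ∷ _} eq = cong₂ _∷_ (⟦⟧-injective p (∷-injectiveˡ eq)) (injective f-sym (∷-injectiveʳ eq))
  distinct : ∀ {a b} → a ≢ b → ⟦ p ⟧ a ≢ ⟦ p ⟧ b
  distinct a≢b = a≢b ∘ ⟦⟧-injective p
  sep : ∀ x y z → Separated x y z → Separated (liftWith p _ x) (liftWith p _ y) (liftWith p _ z)
  sep (_ ∷ _) (_ ∷ _) (_ ∷ _) (0F , a≢b , b≢c , a≢c) = 0F , distinct a≢b , distinct b≢c , distinct a≢c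
  sep (_ ∷ x) (_ ∷ y) (_ ∷ z) (suc i , s) with j , s′ ← separated f-sym x y z (i , s) = suc j , s′

-- σ permutes the coordinates (when Valid) and π i permutes the symbols of coordinate i.
Symmetry : ℕ → Set
Symmetry n = Vec (Fin n) n × Vec Perm₃ n

apply : ∀ {n} → Symmetry n → Word n → Word n
apply (σ , π) x = tabulate λ i → ⟦ lookup π i ⟧ (lookup x (lookup σ i))

Valid : ∀ {n} → Symmetry n → Set
Valid (σ , _) = ∀ j → ∃ λ i → lookup σ i ≡ j

valid? : ∀ {n} (g : Symmetry n) → Dec (Valid g)
valid? (σ , _) = allᶠ? λ j → anyᶠ? λ i → lookup σ i ≟ᶠ j

lookup-apply : ∀ {n} σ π (x : Word n) i →
               lookup (apply (σ , π) x) i ≡ ⟦ lookup π i ⟧ (lookup x (lookup σ i))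
lookup-apply σ π x i = lookup∘tabulate _ i

lookup-ext : ∀ {A : Set} {n} {xs ys : Vec A n} → (∀ i → lookup xs i ≡ lookup ys i) → xs ≡ ys
lookup-ext {xs = xs} {ys} eq = begin
  xs                  ≡⟨ tabulate∘lookup xs ⟨
  tabulate (lookup xs) ≡⟨ tabulate-cong eq ⟩
  tabulate (lookup ys) ≡⟨ tabulate∘lookup ys ⟩
  ys                  ∎
  where open ≡-Reasoning

apply-IsSymmetry : ∀ {n} {g : Symmetry n} → Valid g → IsSymmetry (apply g)
apply-IsSymmetry {g = σ , π} onto = record { injective = inj ; separated = sep }
  where
  reflect : ∀ x y i → lookup (apply (σ , π) x) i ≡ lookup (apply (σ , π) y) i →
            lookup x (lookup σ i) ≡ lookup y (lookup σ i)
  reflect x y i eq =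
    ⟦⟧-injective (lookup π i) (trans (sym (lookup-apply σ π x i)) (trans eq (lookup-apply σ π y i)))
  inj : ∀ {x y} → apply (σ , π) x ≡ apply (σ , π) y → x ≡ y
  inj {x} {y} eq = lookup-ext λ j → let i , σi≡j = onto j in
    subst (λ k → lookup x k ≡ lookup y k) σi≡j (reflect x y i (cong (λ v → lookup v i) eq))
  sep : ∀ x y z → Separated x y z → Separated (apply (σ , π) x) (apply (σ , π) y) (apply (σ , π) z)
  sep x y z (j , x≢y , y≢z , x≢z) with i , refl ← onto j =
    i , x≢y ∘ reflect x y i , y≢z ∘ reflect y z i , x≢z ∘ reflect x z i

-- search fuel S cands t plan certs explores the codes C ⊇ S of size at least |S| + t whose other
-- words lie in cands and which meet every set of plan; each leaf consumes the next certificate,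
-- which must accept the words chosen there, and the unused certificates are returned.
module Search {n : ℕ} {Cert : Set} (Accepts : Cert → List (Word n) → Set)
              (accepts? : ∀ c S → Dec (Accepts c S)) where

  Compatible : List (Word n) → Word n → Word n → Set
  Compatible S x w = w ≢ x × All (λ s → Separated s x w) S

  compatible? : ∀ S x w → Dec (Compatible S x w)
  compatible? S x w = ¬? (w ≟ʷ x) ×-dec All.all? (λ s → separated? s x w) S

  extend : List (Word n) → Word n → List (Word n) → List (Word n)
  extend S x = filter (compatible? S x)

  mutual
    search : ℕ → List (Word n) → List (Word n) → ℕ → List (List (Word n)) → List Cert → Maybe (List Cert)
    search zero    S cands t       plan       cs       = nothing
    search (suc f) S cands zero    (X ∷ plan) cs       = nothing
    search (suc f) S cands (suc t) (X ∷ plan) cs       = searchAmong f S cands t plan X cs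
    search (suc f) S cands zero    []         []       = nothing
    search (suc f) S cands zero    []         (c ∷ cs) with accepts? c S
    ... | yes _ = just cs
    ... | no  _ = nothing
    search (suc f) S cands (suc t) []         cs       with length cands <? suc t
    ... | yes _ = just cs
    ... | no  _ = branch f S cands t cs

    searchAmong : ℕ → List (Word n) → List (Word n) → ℕ → List (List (Word n)) → List (Word n) →
                  List Cert → Maybe (List Cert)
    searchAmong f S cands t plan []      cs = just cs
    searchAmong f S cands t plan (x ∷ X) cs with x ∈ʷ? cands | x ∈ʷ? S
    ... | yes _ | _     = search f (x ∷ S) (extend S x cands) t plan cs
                            >>= searchAmong f S cands t plan X
    ... | no _  | yes _ = search f S cands (suc t) plan cs >>= searchAmong f S cands t plan X
    ... | no _  | no _  = searchAmong f S cands t plan X cs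

    branch : ℕ → List (Word n) → List (Word n) → ℕ → List Cert → Maybe (List Cert)
    branch f S []         t cs = just cs
    branch f S (v ∷ rest) t cs =
      search f (v ∷ S) (extend S v rest) t [] cs >>= search f S rest (suc t) []

  searchAmong-rest : ∀ f S cands t plan x X cs {cs′} →
                     searchAmong f S cands t plan (x ∷ X) cs ≡ just cs′ →
                     ∃ λ cs₁ → searchAmong f S cands t plan X cs₁ ≡ just cs′
  searchAmong-rest f S cands t plan x X cs eq with x ∈ʷ? cands | x ∈ʷ? S
  ... | yes _ | _     = Product.map₂ proj₂ (>>=-just (search f (x ∷ S) (extend S x cands) t plan cs) eq)
  ... | no _  | yes _ = Product.map₂ proj₂ (>>=-just (search f S cands (suc t) plan cs) eq)
  ... | no _  | no _  = cs , eq

  record Invariant (C S cands : List (Word n)) : Set where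
    field
      covered : ∀ {x} → x ∈ C → x ∈ S ⊎ x ∈ cands
      chosen  : S ⊆ C
      fresh   : ∀ {w} → w ∈ cands → w ∉ S

  open Invariant

  start : ∀ C → Invariant C [] (allWords n)
  start C = record { covered = λ {x} _ → inj₂ (∈-allWords x) ; chosen = λ () ; fresh = λ _ () }

  module _ {C : List (Word n)} (unique : Unique C) (trifferent : Trifferent C) where

    Found : Set
    Found = ∃₂ λ S c → S ⊆ C × Accepts c S

    cannot-complete : ∀ {S cands t} → Invariant C S cands → length cands < t →
                      length S + t ≤ length C → ⊥
    cannot-complete {S} {cands} {t} inv short size = <-irrefl refl (begin-strict
      length C                ≤⟨ unique-⊆⇒length≤ unique C⊆S++cands ⟩
      length (S ++ cands)     ≡⟨ length-++ S ⟩
      length S + length cands <⟨ +-monoʳ-< (length S) short ⟩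
      length S + t            ≤⟨ size ⟩
      length C                ∎)
      where
      open ≤-Reasoning
      C⊆S++cands : C ⊆ S ++ cands
      C⊆S++cands x∈C = [ ∈-++⁺ˡ , ∈-++⁺ʳ S ]′ (covered inv x∈C)

    one-more : ∀ (S : List (Word n)) {t} → length S + suc t ≤ length C → suc (length S + t) ≤ length C
    one-more S {t} = subst (_≤ length C) (+-suc (length S) t)

    extend-complete : ∀ {S x y} cands → x ∈ C → x ∉ S → S ⊆ C → y ∈ C → y ∉ S → y ≢ x →
                      y ∈ cands → y ∈ extend S x cands
    extend-complete {S} {x} {y} cands x∈C x∉S S⊆C y∈C y∉S y≢x y∈cands =
      ∈-filter⁺ (compatible? S x) y∈cands (y≢x , All.tabulate λ {s} s∈S →
        trifferent s x y (S⊆C s∈S) x∈C y∈C (λ { refl → x∉S s∈S }) (y≢x ∘ sym) (λ { refl → y∉S s∈S }))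

    Invariant-add : ∀ {S cands cands₀ x} → Invariant C S cands → x ∈ C → x ∈ cands →
                    (∀ {y} → y ∈ cands → y ≢ x → y ∈ cands₀) → cands₀ ⊆ cands →
                    Invariant C (x ∷ S) (extend S x cands₀)
    Invariant-add {S} {cands} {cands₀} {x} inv x∈C x∈cands keep cands₀⊆cands = record
      { covered = cov ; chosen = λ { (here refl) → x∈C ; (there s∈S) → chosen inv s∈S } ; fresh = fr }
      where
      cov : ∀ {y} → y ∈ C → y ∈ x ∷ S ⊎ y ∈ extend S x cands₀
      cov {y} y∈C with covered inv y∈C | y ≟ʷ x
      ... | inj₁ y∈S     | _        = inj₁ (there y∈S)
      ... | inj₂ _       | yes refl = inj₁ (here refl)
      ... | inj₂ y∈cands | no y≢x   = inj₂ (extend-complete cands₀ x∈C (fresh inv x∈cands) (chosen inv)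
                                                            y∈C (fresh inv y∈cands) y≢x (keep y∈cands y≢x))
      fr : ∀ {w} → w ∈ extend S x cands₀ → w ∉ x ∷ S
      fr w∈ with w∈cands₀ , w≢x , _ ← ∈-filter⁻ (compatible? S x) w∈ = λ where
        (here w≡x)  → w≢x w≡x
        (there w∈S) → fresh inv (cands₀⊆cands w∈cands₀) w∈S

    Invariant-drop : ∀ {S v rest} → Invariant C S (v ∷ rest) → v ∉ C → Invariant C S rest
    Invariant-drop inv v∉C = record
      { covered = λ y∈C → Sum.map₂ (λ { (here refl) → ⊥-elim (v∉C y∈C) ; (there y∈rest) → y∈rest })
                                   (covered inv y∈C)
      ; chosen  = chosen inv
      ; fresh   = fresh inv ∘ there
      }

    mutual
      search-sound : ∀ f S cands t plan cs {cs′} → search f S cands t plan cs ≡ just cs′ →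
                     Invariant C S cands → All (Any (_∈ C)) plan → length S + t ≤ length C → Found
      search-sound zero S cands t plan cs () inv met size
      search-sound (suc f) S cands zero (X ∷ plan) cs () inv met size
      search-sound (suc f) S cands (suc t) (X ∷ plan) cs eq inv (hit ∷ met) size =
        searchAmong-sound f S cands t plan X cs eq inv met hit size
      search-sound (suc f) S cands zero [] [] () inv met size
      search-sound (suc f) S cands zero [] (c ∷ cs) eq inv met size with accepts? c S
      search-sound (suc f) S cands zero [] (c ∷ cs) eq inv met size | yes acc = S , c , chosen inv , acc
      search-sound (suc f) S cands zero [] (c ∷ cs) () inv met size | no _
      search-sound (suc f) S cands (suc t) [] cs eq inv met size with length cands <? suc t
      ... | yes short = ⊥-elim (cannot-complete inv short size)
      ... | no _      = branch-sound f S cands t cs eq inv size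

      searchAmong-sound : ∀ f S cands t plan X cs {cs′} → searchAmong f S cands t plan X cs ≡ just cs′ →
                          Invariant C S cands → All (Any (_∈ C)) plan → Any (_∈ C) X →
                          length S + suc t ≤ length C → Found
      searchAmong-sound f S cands t plan (x ∷ X) cs eq inv met (there hit) size =
        let cs₁ , eq₁ = searchAmong-rest f S cands t plan x X cs eq in
        searchAmong-sound f S cands t plan X cs₁ eq₁ inv met hit size
      searchAmong-sound f S cands t plan (x ∷ X) cs eq inv met (here x∈C) size with x ∈ʷ? cands | x ∈ʷ? S
      ... | yes x∈cands | _ =
        let _ , found , _ = >>=-just (search f (x ∷ S) (extend S x cands) t plan cs) eq in
        search-sound f (x ∷ S) (extend S x cands) t plan cs found
          (Invariant-add inv x∈C x∈cands (λ y∈ _ → y∈) id) met (one-more S size)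
      ... | no _ | yes _ =
        let _ , found , _ = >>=-just (search f S cands (suc t) plan cs) eq in
        search-sound f S cands (suc t) plan cs found inv met size
      ... | no x∉cands | no x∉S = ⊥-elim ([ x∉S , x∉cands ]′ (covered inv x∈C))

      branch-sound : ∀ f S cands t cs {cs′} → branch f S cands t cs ≡ just cs′ →
                     Invariant C S cands → length S + suc t ≤ length C → Found
      branch-sound f S [] t cs eq inv size = ⊥-elim (cannot-complete inv (s≤s z≤n) size)
      branch-sound f S (v ∷ rest) t cs eq inv size
        with cs₁ , eq₁ , eq₂ ← >>=-just (search f (v ∷ S) (extend S v rest) t [] cs) eq | v ∈ʷ? C
      ... | yes v∈C = search-sound f (v ∷ S) (extend S v rest) t [] cs eq₁
                        (Invariant-add inv v∈C (here refl) keep there) [] (one-more S size)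
        where
        keep : ∀ {y} → y ∈ v ∷ rest → y ≢ v → y ∈ rest
        keep (here y≡v)   y≢v = ⊥-elim (y≢v y≡v)
        keep (there y∈rest) _ = y∈rest
      ... | no v∉C = search-sound f S rest (suc t) [] cs₁ eq₂ (Invariant-drop inv v∉C) [] size

avoiding : ∀ {n} → Fin 3 → List (Word (suc n)) → List (Word (suc n))
avoiding a = filter λ x → ¬? (head x ≟ᶠ a)

∈-avoiding⁻ : ∀ {n} a {C : List (Word (suc n))} {x} → x ∈ avoiding a C → x ∈ C × head x ≢ a
∈-avoiding⁻ a = ∈-filter⁻ (λ x → ¬? (head x ≟ᶠ a))

punctured : ∀ {n} → Fin 3 → List (Word (suc n)) → List (Word n)
punctured a C = map tail (avoiding a C)

tail-separated : ∀ {n a} (x y z : Word (suc n)) → head x ≢ a → head y ≢ a → head z ≢ a →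
                 Separated x y z → Separated (tail x) (tail y) (tail z)
tail-separated (_ ∷ _) (_ ∷ _) (_ ∷ _) hx hy hz (0F , x≢y , y≢z , x≢z) =
  ⊥-elim ([ x≢y , [ y≢z , x≢z ]′ ]′ (collision₃-avoiding hx hy hz))
tail-separated (_ ∷ _) (_ ∷ _) (_ ∷ _) _ _ _ (suc i , s) = i , s

punctured-Trifferent : ∀ {n} a {C : List (Word (suc n))} → Trifferent C → Trifferent (punctured a C)
punctured-Trifferent a tri _ _ _ x′∈ y′∈ z′∈ x′≢y′ y′≢z′ x′≢z′
  with x , x∈A , refl ← ∈-map⁻ tail x′∈
     | y , y∈A , refl ← ∈-map⁻ tail y′∈
     | z , z∈A , refl ← ∈-map⁻ tail z′∈
  with x∈C , hx ← ∈-avoiding⁻ a x∈A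
     | y∈C , hy ← ∈-avoiding⁻ a y∈A
     | z∈C , hz ← ∈-avoiding⁻ a z∈A
  = tail-separated x y z hx hy hz
      (tri x y z x∈C y∈C z∈C (x′≢y′ ∘ cong tail) (y′≢z′ ∘ cong tail) (x′≢z′ ∘ cong tail))

-- Two codewords with equal tails would not be separated from any third one.
punctured-Unique : ∀ {n} a {C : List (Word (suc n))} → Unique C → Trifferent C →
                   3 ≤ length (avoiding a C) → Unique (punctured a C)
punctured-Unique a {C} u tri 3≤ = unique-map⁺ tail tail-injective (Unique.filter⁺ _ u)
  where
  tail-injective : ∀ {x y} → x ∈ avoiding a C → y ∈ avoiding a C → x ≢ y → tail x ≢ tail y
  tail-injective {x} {y} x∈A y∈A x≢y tx≡ty
    with z , z∈A , z≢x , z≢y ← third-element _≟ʷ_ x y (Unique.filter⁺ _ u) 3≤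
    with x∈C , hx ← ∈-avoiding⁻ a x∈A
       | y∈C , hy ← ∈-avoiding⁻ a y∈A
       | z∈C , hz ← ∈-avoiding⁻ a z∈A
    with i , tx≢ty , _ ← tail-separated x y z hx hy hz (tri x y z x∈C y∈C z∈C x≢y (z≢y ∘ sym) (z≢x ∘ sym))
    = tx≢ty (cong (λ w → lookup w i) tx≡ty)

avoidances : ∀ {n} → List (Word (suc n)) → ℕ
avoidances C = length (avoiding 0F C) + length (avoiding 1F C) + length (avoiding 2F C)

avoidances-∷ : ∀ {n} (w : Word (suc n)) C → avoidances (w ∷ C) ≡ 2 + avoidances C
avoidances-∷ (0F ∷ _) C = shift (length (avoiding 0F C)) (length (avoiding 1F C)) (length (avoiding 2F C))
  where
  shift : ∀ x y z → x + suc y + suc z ≡ 2 + (x + y + z)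
  shift = solve-∀
avoidances-∷ (1F ∷ _) C = shift (length (avoiding 0F C)) (length (avoiding 1F C)) (length (avoiding 2F C))
  where
  shift : ∀ x y z → suc x + y + suc z ≡ 2 + (x + y + z)
  shift = solve-∀
avoidances-∷ (2F ∷ _) C = shift (length (avoiding 0F C)) (length (avoiding 1F C)) (length (avoiding 2F C))
  where
  shift : ∀ x y z → suc x + suc y + z ≡ 2 + (x + y + z)
  shift = solve-∀

avoidances≡2*length : ∀ {n} (C : List (Word (suc n))) → avoidances C ≡ 2 * length C
avoidances≡2*length []      = refl
avoidances≡2*length (w ∷ C) = begin
  avoidances (w ∷ C)  ≡⟨ avoidances-∷ w C ⟩
  2 + avoidances C    ≡⟨ cong (2 +_) (avoidances≡2*length C) ⟩
  2 + 2 * length C    ≡⟨ *-suc 2 (length C) ⟨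
  2 * length (w ∷ C)  ∎
  where open ≡-Reasoning

large-avoiding : ∀ {n k m} (C : List (Word (suc n))) → 3 * m ≤ 2 + 2 * k → k ≤ length C →
                 ∃ λ a → m ≤ length (avoiding a C)
large-avoiding {k = k} {m} C 3m≤2+2k k≤∣C∣
  with m ≤? length (avoiding 0F C) | m ≤? length (avoiding 1F C) | m ≤? length (avoiding 2F C)
... | yes m≤ | _      | _      = 0F , m≤
... | no _   | yes m≤ | _      = 1F , m≤
... | no _   | no _   | yes m≤ = 2F , m≤
... | no m≰x | no m≰y | no m≰z = ⊥-elim (<-irrefl refl (begin
  3 + avoidances C                                ≡⟨ shift x y z ⟩
  suc x + suc y + suc z                           ≤⟨ +-mono-≤ (+-mono-≤ (≰⇒> m≰x) (≰⇒> m≰y)) (≰⇒> m≰z) ⟩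
  m + m + m                                       ≡⟨ triple m ⟩
  3 * m                                           ≤⟨ 3m≤2+2k ⟩
  2 + 2 * k                                       ≤⟨ +-monoʳ-≤ 2 (*-monoʳ-≤ 2 k≤∣C∣) ⟩
  2 + 2 * length C                                ≡⟨ cong (2 +_) (avoidances≡2*length C) ⟨
  2 + avoidances C                                ∎))
  where
  open ≤-Reasoning
  x = length (avoiding 0F C)
  y = length (avoiding 1F C)
  z = length (avoiding 2F C)
  shift : ∀ x y z → 3 + (x + y + z) ≡ suc x + suc y + suc z
  shift = solve-∀
  triple : ∀ m → m + m + m ≡ 3 * m
  triple = solve-∀

Normalises : ∀ {n} → List (List (Word n)) → Symmetry n → List (Word n) → Set
Normalises reps g S = Valid g × Any (_⊆ map (apply g) S) reps

normalises? : ∀ {n} reps (g : Symmetry n) S → Dec (Normalises reps g S)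
normalises? reps g S = valid? g ×-dec Any.any? (_⊆ʷ? map (apply g) S) reps

Classification : ∀ n → ℕ → List (List (Word n)) → Set
Classification n k reps =
  ∀ C → Unique C → Trifferent C → k ≤ length C → ∃ λ f → IsSymmetry f × Any (_⊆ map f C) reps

fuel : ℕ
fuel = 2000

module _ {n : ℕ} (reps : List (List (Word n))) where

  open Search (Normalises reps) (normalises? reps)

  certify : ℕ → List (List (Word n)) → List (Symmetry n) → Maybe (List (Symmetry n))
  certify k plan certs = search fuel [] (allWords n) k plan certs

  normalise-by-search : ∀ {f : Word n → Word n} {C k plan certs rest} →
                        IsSymmetry f → Unique C → Trifferent C → k ≤ length C →
                        All (Any (_∈ map f C)) plan → certify k plan certs ≡ just rest →
                        ∃ λ h → IsSymmetry h × Any (_⊆ map h C) reps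
  normalise-by-search {f} {C} {k} {plan} {certs} f-sym u tri k≤∣C∣ met found
    with S , g , S⊆fC , g-valid , hit ←
           search-sound (map-Unique f-sym u) (map-Trifferent f-sym tri) fuel [] (allWords n) k plan
             certs found (start (map f C)) met (subst (k ≤_) (sym (length-map f C)) k≤∣C∣)
    = apply g ∘ f , ∘-IsSymmetry (apply-IsSymmetry {g = g} g-valid) f-sym
    , Any.map transport hit
    where
    transport : ∀ {R} → R ⊆ map (apply g) S → R ⊆ map (apply g ∘ f) C
    transport R⊆gS = subst (_ ⊆_) (sym (map-∘ C)) (⊆-trans R⊆gS (⊆-map⁺ (apply g) S⊆fC))

  classification-by-search : ∀ {k certs rest} → certify k [] certs ≡ just rest → Classification n k reps
  classification-by-search found C u tri k≤∣C∣ = normalise-by-search id-IsSymmetry u tri k≤∣C∣ [] found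

lifts : ∀ {n} → Word n → List (Word (suc n))
lifts r = (1F ∷ r) ∷ (2F ∷ r) ∷ []

verify : ∀ {n} → List (List (Word n)) → ℕ → List (List (Word (suc n))) →
         List (Symmetry (suc n)) → Maybe (List (Symmetry (suc n)))
verify []       k new certs = just certs
verify (R ∷ Rs) k new certs = certify new k (map lifts R) certs >>= verify Rs k new

verify-sound : ∀ {n} (old : List (List (Word n))) {k new certs rest} → verify old k new certs ≡ just rest →
               ∀ {R} → R ∈ old → ∃₂ λ certs₁ rest₁ → certify new k (map lifts R) certs₁ ≡ just rest₁
verify-sound (R ∷ Rs) {k} {new} {certs} eq (here refl) =
  let rest₁ , eq₁ , _ = >>=-just (certify new k (map lifts R) certs) eq in certs , rest₁ , eq₁
verify-sound (R ∷ Rs) {k} {new} {certs} eq (there R∈Rs) =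
  let _ , _ , eq₂ = >>=-just (certify new k (map lifts R) certs) eq in verify-sound Rs eq₂ R∈Rs

-- sendTo0 a moves the avoided symbol to 0, so the lifted codewords begin with 1 or 2.
lifts-hit : ∀ {n} a {C : List (Word (suc n))} {f : Word n → Word n} {R} → R ⊆ map f (punctured a C) →
            All (Any (_∈ map (liftWith (sendTo0 a) f) C)) (map lifts R)
lifts-hit a {C} {f} {R} R⊆ = All.map⁺ (All.tabulate hit)
  where
  lifted : ∀ {h t b} → ⟦ sendTo0 a ⟧ h ≡ b → (h ∷ t) ∈ C → b ∷ f t ∈ map (liftWith (sendTo0 a) f) C
  lifted refl = ∈-map⁺ (liftWith (sendTo0 a) f)
  hit : ∀ {r} → r ∈ R → Any (_∈ map (liftWith (sendTo0 a) f) C) (lifts r)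
  hit r∈R with _ , y∈ , refl ← ∈-map⁻ f (R⊆ r∈R)
    with (h ∷ t) , x∈A , refl ← ∈-map⁻ tail y∈
    with x∈C , h≢a ← ∈-avoiding⁻ a {C} x∈A
    with sendTo0-others a h≢a
  ... | inj₁ eq = here (lifted eq x∈C)
  ... | inj₂ eq = there (here (lifted eq x∈C))

extend-classification : ∀ {n kp k} {old : List (List (Word n))} {new certs rest} →
                        Classification n kp old → {True (3 ≤? kp)} → {True (3 * kp ≤? 2 + 2 * k)} →
                        verify old k new certs ≡ just rest → Classification (suc n) k new
extend-classification {kp = kp} {k} {old} {new} classify {3≤kp} {3kp≤2+2k} verified C u tri k≤∣C∣
  with a , kp≤∣A∣ ← large-avoiding C (toWitness 3kp≤2+2k) k≤∣C∣
  with f , f-sym , hit ← classify (punctured a C)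
                           (punctured-Unique a u tri (≤-trans (toWitness 3≤kp) kp≤∣A∣))
                           (punctured-Trifferent a tri)
                           (subst (kp ≤_) (sym (length-map tail (avoiding a C))) kp≤∣A∣)
  with R , R∈old , R⊆ ← find hit
  with _ , _ , found ← verify-sound old verified R∈old
  = normalise-by-search new (liftWith-IsSymmetry (sendTo0 a) f-sym) u tri k≤∣C∣ (lifts-hit a R⊆) found

bound-from-empty-classification : ∀ {n m} → Classification n (suc m) [] →
                                  ∀ (C : List (Word n)) → Unique C → Trifferent C → length C ≤ m
bound-from-empty-classification {m = m} classify C u tri with suc m ≤? length C
... | yes m<∣C∣ with _ , _ , () ← classify C u tri m<∣C∣
... | no m≮∣C∣ = ≤-pred (≰⇒> m≮∣C∣)

-- Found by running the same search outside Agda: certsₙ lists, in the order in which the search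
-- reaches its leaves, a symmetry taking each leaf onto a superset of a member of repsₙ.
reps₂ : List (List (Word 2))
reps₂ =
  ((0F ∷ 0F ∷ []) ∷ (0F ∷ 1F ∷ []) ∷ (1F ∷ 2F ∷ []) ∷ (2F ∷ 2F ∷ []) ∷ [])
  ∷ []
certs₂ : List (Symmetry 2)
certs₂ =
  ((0F ∷ 1F ∷ []) , (π012 ∷ π012 ∷ []))
  ∷ ((0F ∷ 1F ∷ []) , (π012 ∷ π021 ∷ []))
  ∷ ((0F ∷ 1F ∷ []) , (π120 ∷ π201 ∷ []))
  ∷ ((0F ∷ 1F ∷ []) , (π102 ∷ π201 ∷ []))
  ∷ ((0F ∷ 1F ∷ []) , (π012 ∷ π201 ∷ []))
  ∷ ((0F ∷ 1F ∷ []) , (π102 ∷ π021 ∷ []))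
  ∷ ((0F ∷ 1F ∷ []) , (π120 ∷ π021 ∷ []))
  ∷ ((0F ∷ 1F ∷ []) , (π102 ∷ π012 ∷ []))
  ∷ ((0F ∷ 1F ∷ []) , (π120 ∷ π012 ∷ []))
  ∷ []

reps₃ : List (List (Word 3))
reps₃ =
  ((0F ∷ 2F ∷ 2F ∷ []) ∷ (1F ∷ 0F ∷ 0F ∷ []) ∷ (1F ∷ 0F ∷ 1F ∷ []) ∷ (1F ∷ 1F ∷ 2F ∷ []) ∷ (2F ∷ 2F ∷ 2F ∷ []) ∷ [])
  ∷ ((0F ∷ 1F ∷ 1F ∷ []) ∷ (1F ∷ 0F ∷ 0F ∷ []) ∷ (1F ∷ 1F ∷ 2F ∷ []) ∷ (2F ∷ 0F ∷ 1F ∷ []) ∷ (2F ∷ 2F ∷ 2F ∷ []) ∷ [])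
  ∷ []
certs₃ : List (Symmetry 3)
certs₃ =
  ((0F ∷ 1F ∷ 2F ∷ []) , (π012 ∷ π012 ∷ π012 ∷ []))
  ∷ ((0F ∷ 1F ∷ 2F ∷ []) , (π012 ∷ π021 ∷ π012 ∷ []))
  ∷ ((1F ∷ 0F ∷ 2F ∷ []) , (π102 ∷ π102 ∷ π012 ∷ []))
  ∷ ((0F ∷ 2F ∷ 1F ∷ []) , (π012 ∷ π120 ∷ π201 ∷ []))
  ∷ ((0F ∷ 1F ∷ 2F ∷ []) , (π012 ∷ π012 ∷ π012 ∷ []))
  ∷ ((0F ∷ 2F ∷ 1F ∷ []) , (π012 ∷ π120 ∷ π201 ∷ []))
  ∷ ((0F ∷ 2F ∷ 1F ∷ []) , (π012 ∷ π120 ∷ π210 ∷ []))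
  ∷ ((0F ∷ 1F ∷ 2F ∷ []) , (π012 ∷ π021 ∷ π012 ∷ []))
  ∷ ((0F ∷ 2F ∷ 1F ∷ []) , (π021 ∷ π210 ∷ π201 ∷ []))
  ∷ ((0F ∷ 2F ∷ 1F ∷ []) , (π012 ∷ π210 ∷ π201 ∷ []))
  ∷ ((0F ∷ 1F ∷ 2F ∷ []) , (π012 ∷ π012 ∷ π102 ∷ []))
  ∷ ((0F ∷ 2F ∷ 1F ∷ []) , (π012 ∷ π210 ∷ π201 ∷ []))
  ∷ ((0F ∷ 2F ∷ 1F ∷ []) , (π012 ∷ π210 ∷ π210 ∷ []))
  ∷ ((0F ∷ 1F ∷ 2F ∷ []) , (π012 ∷ π021 ∷ π102 ∷ []))
  ∷ ((0F ∷ 2F ∷ 1F ∷ []) , (π021 ∷ π120 ∷ π201 ∷ []))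
  ∷ ((1F ∷ 0F ∷ 2F ∷ []) , (π102 ∷ π120 ∷ π012 ∷ []))
  ∷ ((0F ∷ 1F ∷ 2F ∷ []) , (π021 ∷ π021 ∷ π012 ∷ []))
  ∷ ((0F ∷ 1F ∷ 2F ∷ []) , (π021 ∷ π012 ∷ π012 ∷ []))
  ∷ []

reps₄ : List (List (Word 4))
reps₄ =
  ((0F ∷ 0F ∷ 1F ∷ 2F ∷ []) ∷ (0F ∷ 2F ∷ 0F ∷ 2F ∷ []) ∷ (1F ∷ 0F ∷ 2F ∷ 2F ∷ []) ∷ (1F ∷ 1F ∷ 0F ∷ 0F ∷ []) ∷ (1F ∷ 1F ∷ 0F ∷ 1F ∷ []) ∷ (2F ∷ 1F ∷ 1F ∷ 2F ∷ []) ∷ (2F ∷ 2F ∷ 2F ∷ 2F ∷ []) ∷ [])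
  ∷ ((0F ∷ 0F ∷ 0F ∷ 1F ∷ []) ∷ (0F ∷ 2F ∷ 1F ∷ 1F ∷ []) ∷ (1F ∷ 0F ∷ 2F ∷ 2F ∷ []) ∷ (1F ∷ 1F ∷ 0F ∷ 0F ∷ []) ∷ (1F ∷ 1F ∷ 1F ∷ 2F ∷ []) ∷ (2F ∷ 1F ∷ 0F ∷ 1F ∷ []) ∷ (2F ∷ 2F ∷ 2F ∷ 2F ∷ []) ∷ [])
  ∷ ((0F ∷ 0F ∷ 0F ∷ 2F ∷ []) ∷ (0F ∷ 1F ∷ 2F ∷ 1F ∷ []) ∷ (1F ∷ 0F ∷ 1F ∷ 1F ∷ []) ∷ (1F ∷ 1F ∷ 0F ∷ 0F ∷ []) ∷ (1F ∷ 2F ∷ 2F ∷ 2F ∷ []) ∷ (2F ∷ 1F ∷ 1F ∷ 2F ∷ []) ∷ (2F ∷ 2F ∷ 0F ∷ 1F ∷ []) ∷ [])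
  ∷ []
certs₄ : List (Symmetry 4)
certs₄ =
  ((0F ∷ 1F ∷ 2F ∷ 3F ∷ []) , (π012 ∷ π012 ∷ π012 ∷ π012 ∷ []))
  ∷ ((0F ∷ 1F ∷ 2F ∷ 3F ∷ []) , (π012 ∷ π012 ∷ π012 ∷ π012 ∷ []))
  ∷ ((1F ∷ 0F ∷ 3F ∷ 2F ∷ []) , (π210 ∷ π210 ∷ π120 ∷ π201 ∷ []))
  ∷ ((0F ∷ 3F ∷ 2F ∷ 1F ∷ []) , (π012 ∷ π021 ∷ π210 ∷ π021 ∷ []))
  ∷ ((0F ∷ 3F ∷ 2F ∷ 1F ∷ []) , (π012 ∷ π021 ∷ π210 ∷ π021 ∷ []))
  ∷ ((0F ∷ 3F ∷ 2F ∷ 1F ∷ []) , (π021 ∷ π201 ∷ π210 ∷ π120 ∷ []))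
  ∷ ((0F ∷ 1F ∷ 2F ∷ 3F ∷ []) , (π021 ∷ π210 ∷ π012 ∷ π102 ∷ []))
  ∷ ((1F ∷ 0F ∷ 3F ∷ 2F ∷ []) , (π012 ∷ π201 ∷ π210 ∷ π201 ∷ []))
  ∷ ((0F ∷ 1F ∷ 2F ∷ 3F ∷ []) , (π012 ∷ π012 ∷ π012 ∷ π102 ∷ []))
  ∷ ((1F ∷ 0F ∷ 3F ∷ 2F ∷ []) , (π210 ∷ π210 ∷ π210 ∷ π201 ∷ []))
  ∷ ((0F ∷ 3F ∷ 2F ∷ 1F ∷ []) , (π012 ∷ π201 ∷ π210 ∷ π021 ∷ []))
  ∷ ((0F ∷ 3F ∷ 2F ∷ 1F ∷ []) , (π012 ∷ π201 ∷ π210 ∷ π021 ∷ []))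
  ∷ ((0F ∷ 3F ∷ 2F ∷ 1F ∷ []) , (π021 ∷ π021 ∷ π210 ∷ π120 ∷ []))
  ∷ ((0F ∷ 1F ∷ 2F ∷ 3F ∷ []) , (π021 ∷ π210 ∷ π012 ∷ π012 ∷ []))
  ∷ ((1F ∷ 0F ∷ 3F ∷ 2F ∷ []) , (π012 ∷ π201 ∷ π120 ∷ π201 ∷ []))
  ∷ ((0F ∷ 1F ∷ 2F ∷ 3F ∷ []) , (π021 ∷ π210 ∷ π012 ∷ π012 ∷ []))
  ∷ ((0F ∷ 1F ∷ 2F ∷ 3F ∷ []) , (π012 ∷ π210 ∷ π012 ∷ π012 ∷ []))
  ∷ ((0F ∷ 3F ∷ 2F ∷ 1F ∷ []) , (π012 ∷ π021 ∷ π210 ∷ π120 ∷ []))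
  ∷ ((0F ∷ 1F ∷ 2F ∷ 3F ∷ []) , (π012 ∷ π210 ∷ π012 ∷ π012 ∷ []))
  ∷ ((1F ∷ 0F ∷ 3F ∷ 2F ∷ []) , (π012 ∷ π210 ∷ π120 ∷ π201 ∷ []))
  ∷ ((0F ∷ 3F ∷ 2F ∷ 1F ∷ []) , (π021 ∷ π201 ∷ π210 ∷ π021 ∷ []))
  ∷ ((0F ∷ 1F ∷ 2F ∷ 3F ∷ []) , (π021 ∷ π012 ∷ π012 ∷ π102 ∷ []))
  ∷ ((1F ∷ 0F ∷ 3F ∷ 2F ∷ []) , (π210 ∷ π201 ∷ π210 ∷ π201 ∷ []))
  ∷ ((0F ∷ 3F ∷ 2F ∷ 1F ∷ []) , (π021 ∷ π201 ∷ π210 ∷ π021 ∷ []))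
  ∷ ((0F ∷ 3F ∷ 2F ∷ 1F ∷ []) , (π012 ∷ π201 ∷ π210 ∷ π120 ∷ []))
  ∷ ((0F ∷ 1F ∷ 2F ∷ 3F ∷ []) , (π012 ∷ π210 ∷ π012 ∷ π102 ∷ []))
  ∷ ((1F ∷ 0F ∷ 3F ∷ 2F ∷ []) , (π012 ∷ π210 ∷ π210 ∷ π201 ∷ []))
  ∷ ((0F ∷ 3F ∷ 2F ∷ 1F ∷ []) , (π021 ∷ π021 ∷ π210 ∷ π021 ∷ []))
  ∷ ((0F ∷ 1F ∷ 2F ∷ 3F ∷ []) , (π021 ∷ π012 ∷ π012 ∷ π012 ∷ []))
  ∷ ((1F ∷ 0F ∷ 3F ∷ 2F ∷ []) , (π210 ∷ π201 ∷ π120 ∷ π201 ∷ []))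
  ∷ ((0F ∷ 3F ∷ 2F ∷ 1F ∷ []) , (π021 ∷ π021 ∷ π210 ∷ π021 ∷ []))
  ∷ ((0F ∷ 1F ∷ 2F ∷ 3F ∷ []) , (π021 ∷ π012 ∷ π012 ∷ π012 ∷ []))
  ∷ ((1F ∷ 2F ∷ 3F ∷ 0F ∷ []) , (π102 ∷ π201 ∷ π021 ∷ π021 ∷ []))
  ∷ ((1F ∷ 3F ∷ 2F ∷ 0F ∷ []) , (π021 ∷ π201 ∷ π210 ∷ π021 ∷ []))
  ∷ ((1F ∷ 2F ∷ 3F ∷ 0F ∷ []) , (π021 ∷ π120 ∷ π102 ∷ π021 ∷ []))
  ∷ ((0F ∷ 2F ∷ 3F ∷ 1F ∷ []) , (π210 ∷ π012 ∷ π201 ∷ π021 ∷ []))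
  ∷ ((1F ∷ 3F ∷ 2F ∷ 0F ∷ []) , (π210 ∷ π120 ∷ π120 ∷ π021 ∷ []))
  ∷ ((1F ∷ 3F ∷ 2F ∷ 0F ∷ []) , (π201 ∷ π210 ∷ π102 ∷ π012 ∷ []))
  ∷ ((1F ∷ 3F ∷ 2F ∷ 0F ∷ []) , (π012 ∷ π021 ∷ π201 ∷ π021 ∷ []))
  ∷ ((0F ∷ 2F ∷ 1F ∷ 3F ∷ []) , (π210 ∷ π102 ∷ π201 ∷ π021 ∷ []))
  ∷ ((2F ∷ 1F ∷ 3F ∷ 0F ∷ []) , (π021 ∷ π120 ∷ π102 ∷ π012 ∷ []))
  ∷ ((2F ∷ 1F ∷ 3F ∷ 0F ∷ []) , (π120 ∷ π210 ∷ π120 ∷ π021 ∷ []))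
  ∷ ((0F ∷ 1F ∷ 2F ∷ 3F ∷ []) , (π012 ∷ π012 ∷ π012 ∷ π012 ∷ []))
  ∷ ((0F ∷ 1F ∷ 3F ∷ 2F ∷ []) , (π012 ∷ π021 ∷ π210 ∷ π210 ∷ []))
  ∷ ((1F ∷ 2F ∷ 3F ∷ 0F ∷ []) , (π102 ∷ π102 ∷ π210 ∷ π012 ∷ []))
  ∷ ((0F ∷ 2F ∷ 3F ∷ 1F ∷ []) , (π012 ∷ π210 ∷ π201 ∷ π021 ∷ []))
  ∷ ((1F ∷ 2F ∷ 3F ∷ 0F ∷ []) , (π012 ∷ π201 ∷ π201 ∷ π021 ∷ []))
  ∷ ((1F ∷ 2F ∷ 3F ∷ 0F ∷ []) , (π021 ∷ π210 ∷ π021 ∷ π012 ∷ []))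
  ∷ ((1F ∷ 0F ∷ 3F ∷ 2F ∷ []) , (π021 ∷ π021 ∷ π210 ∷ π210 ∷ []))
  ∷ ((1F ∷ 2F ∷ 3F ∷ 0F ∷ []) , (π120 ∷ π210 ∷ π210 ∷ π021 ∷ []))
  ∷ ((1F ∷ 2F ∷ 3F ∷ 0F ∷ []) , (π021 ∷ π120 ∷ π012 ∷ π012 ∷ []))
  ∷ ((1F ∷ 2F ∷ 3F ∷ 0F ∷ []) , (π012 ∷ π102 ∷ π012 ∷ π021 ∷ []))
  ∷ ((2F ∷ 0F ∷ 3F ∷ 1F ∷ []) , (π210 ∷ π012 ∷ π201 ∷ π021 ∷ []))
  ∷ ((2F ∷ 1F ∷ 3F ∷ 0F ∷ []) , (π210 ∷ π012 ∷ π021 ∷ π021 ∷ []))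
  ∷ ((2F ∷ 1F ∷ 3F ∷ 0F ∷ []) , (π201 ∷ π021 ∷ π201 ∷ π012 ∷ []))
  ∷ ((0F ∷ 3F ∷ 1F ∷ 2F ∷ []) , (π210 ∷ π201 ∷ π210 ∷ π120 ∷ []))
  ∷ ((2F ∷ 1F ∷ 3F ∷ 0F ∷ []) , (π012 ∷ π102 ∷ π012 ∷ π021 ∷ []))
  ∷ ((2F ∷ 1F ∷ 3F ∷ 0F ∷ []) , (π102 ∷ π201 ∷ π210 ∷ π012 ∷ []))
  ∷ ((0F ∷ 1F ∷ 3F ∷ 2F ∷ []) , (π201 ∷ π201 ∷ π210 ∷ π210 ∷ []))
  ∷ ((1F ∷ 3F ∷ 2F ∷ 0F ∷ []) , (π120 ∷ π102 ∷ π021 ∷ π021 ∷ []))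
  ∷ ((1F ∷ 3F ∷ 2F ∷ 0F ∷ []) , (π021 ∷ π201 ∷ π201 ∷ π012 ∷ []))
  ∷ ((0F ∷ 3F ∷ 2F ∷ 1F ∷ []) , (π210 ∷ π210 ∷ π102 ∷ π012 ∷ []))
  ∷ ((1F ∷ 2F ∷ 3F ∷ 0F ∷ []) , (π210 ∷ π012 ∷ π201 ∷ π012 ∷ []))
  ∷ ((1F ∷ 2F ∷ 3F ∷ 0F ∷ []) , (π201 ∷ π021 ∷ π021 ∷ π021 ∷ []))
  ∷ ((0F ∷ 1F ∷ 2F ∷ 3F ∷ []) , (π201 ∷ π210 ∷ π012 ∷ π012 ∷ []))
  ∷ ((1F ∷ 2F ∷ 3F ∷ 0F ∷ []) , (π102 ∷ π201 ∷ π120 ∷ π021 ∷ []))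
  ∷ ((1F ∷ 2F ∷ 3F ∷ 0F ∷ []) , (π012 ∷ π102 ∷ π102 ∷ π012 ∷ []))
  ∷ ((1F ∷ 0F ∷ 2F ∷ 3F ∷ []) , (π012 ∷ π021 ∷ π012 ∷ π012 ∷ []))
  ∷ ((1F ∷ 3F ∷ 2F ∷ 0F ∷ []) , (π102 ∷ π012 ∷ π012 ∷ π021 ∷ []))
  ∷ ((1F ∷ 3F ∷ 2F ∷ 0F ∷ []) , (π012 ∷ π021 ∷ π210 ∷ π012 ∷ []))
  ∷ ((1F ∷ 3F ∷ 2F ∷ 0F ∷ []) , (π102 ∷ π012 ∷ π102 ∷ π012 ∷ []))
  ∷ ((1F ∷ 3F ∷ 2F ∷ 0F ∷ []) , (π102 ∷ π012 ∷ π102 ∷ π021 ∷ []))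
  ∷ ((1F ∷ 0F ∷ 2F ∷ 3F ∷ []) , (π012 ∷ π012 ∷ π012 ∷ π012 ∷ []))
  ∷ ((1F ∷ 3F ∷ 2F ∷ 0F ∷ []) , (π102 ∷ π012 ∷ π012 ∷ π012 ∷ []))
  ∷ ((1F ∷ 3F ∷ 2F ∷ 0F ∷ []) , (π012 ∷ π021 ∷ π210 ∷ π021 ∷ []))
  ∷ ((0F ∷ 1F ∷ 2F ∷ 3F ∷ []) , (π210 ∷ π210 ∷ π012 ∷ π012 ∷ []))
  ∷ ((1F ∷ 2F ∷ 3F ∷ 0F ∷ []) , (π102 ∷ π201 ∷ π120 ∷ π012 ∷ []))
  ∷ ((1F ∷ 2F ∷ 3F ∷ 0F ∷ []) , (π012 ∷ π102 ∷ π102 ∷ π021 ∷ []))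
  ∷ ((0F ∷ 3F ∷ 2F ∷ 1F ∷ []) , (π201 ∷ π210 ∷ π102 ∷ π012 ∷ []))
  ∷ ((1F ∷ 2F ∷ 3F ∷ 0F ∷ []) , (π210 ∷ π012 ∷ π201 ∷ π021 ∷ []))
  ∷ ((1F ∷ 2F ∷ 3F ∷ 0F ∷ []) , (π201 ∷ π021 ∷ π021 ∷ π012 ∷ []))
  ∷ ((0F ∷ 1F ∷ 3F ∷ 2F ∷ []) , (π210 ∷ π201 ∷ π210 ∷ π210 ∷ []))
  ∷ ((1F ∷ 3F ∷ 2F ∷ 0F ∷ []) , (π120 ∷ π102 ∷ π021 ∷ π012 ∷ []))
  ∷ ((1F ∷ 3F ∷ 2F ∷ 0F ∷ []) , (π021 ∷ π201 ∷ π201 ∷ π021 ∷ []))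
  ∷ ((0F ∷ 3F ∷ 1F ∷ 2F ∷ []) , (π201 ∷ π201 ∷ π210 ∷ π120 ∷ []))
  ∷ ((2F ∷ 1F ∷ 3F ∷ 0F ∷ []) , (π012 ∷ π102 ∷ π012 ∷ π012 ∷ []))
  ∷ ((2F ∷ 1F ∷ 3F ∷ 0F ∷ []) , (π102 ∷ π201 ∷ π210 ∷ π021 ∷ []))
  ∷ ((2F ∷ 0F ∷ 3F ∷ 1F ∷ []) , (π210 ∷ π021 ∷ π201 ∷ π021 ∷ []))
  ∷ ((2F ∷ 1F ∷ 3F ∷ 0F ∷ []) , (π210 ∷ π012 ∷ π021 ∷ π012 ∷ []))
  ∷ ((2F ∷ 1F ∷ 3F ∷ 0F ∷ []) , (π201 ∷ π021 ∷ π201 ∷ π021 ∷ []))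
  ∷ ((1F ∷ 2F ∷ 3F ∷ 0F ∷ []) , (π012 ∷ π102 ∷ π012 ∷ π012 ∷ []))
  ∷ ((1F ∷ 0F ∷ 3F ∷ 2F ∷ []) , (π021 ∷ π012 ∷ π210 ∷ π210 ∷ []))
  ∷ ((1F ∷ 2F ∷ 3F ∷ 0F ∷ []) , (π120 ∷ π210 ∷ π210 ∷ π012 ∷ []))
  ∷ ((1F ∷ 2F ∷ 3F ∷ 0F ∷ []) , (π021 ∷ π120 ∷ π012 ∷ π021 ∷ []))
  ∷ ((0F ∷ 1F ∷ 2F ∷ 3F ∷ []) , (π021 ∷ π012 ∷ π012 ∷ π012 ∷ []))
  ∷ ((0F ∷ 1F ∷ 3F ∷ 2F ∷ []) , (π021 ∷ π021 ∷ π210 ∷ π210 ∷ []))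
  ∷ ((1F ∷ 2F ∷ 3F ∷ 0F ∷ []) , (π102 ∷ π102 ∷ π210 ∷ π021 ∷ []))
  ∷ ((0F ∷ 2F ∷ 3F ∷ 1F ∷ []) , (π021 ∷ π210 ∷ π201 ∷ π021 ∷ []))
  ∷ ((1F ∷ 2F ∷ 3F ∷ 0F ∷ []) , (π012 ∷ π201 ∷ π201 ∷ π012 ∷ []))
  ∷ ((1F ∷ 2F ∷ 3F ∷ 0F ∷ []) , (π021 ∷ π210 ∷ π021 ∷ π021 ∷ []))
  ∷ ((0F ∷ 2F ∷ 1F ∷ 3F ∷ []) , (π201 ∷ π102 ∷ π201 ∷ π021 ∷ []))
  ∷ ((2F ∷ 1F ∷ 3F ∷ 0F ∷ []) , (π021 ∷ π120 ∷ π102 ∷ π021 ∷ []))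
  ∷ ((2F ∷ 1F ∷ 3F ∷ 0F ∷ []) , (π120 ∷ π210 ∷ π120 ∷ π012 ∷ []))
  ∷ ((1F ∷ 3F ∷ 2F ∷ 0F ∷ []) , (π012 ∷ π021 ∷ π201 ∷ π012 ∷ []))
  ∷ ((0F ∷ 2F ∷ 3F ∷ 1F ∷ []) , (π201 ∷ π012 ∷ π201 ∷ π021 ∷ []))
  ∷ ((1F ∷ 3F ∷ 2F ∷ 0F ∷ []) , (π210 ∷ π120 ∷ π120 ∷ π012 ∷ []))
  ∷ ((1F ∷ 3F ∷ 2F ∷ 0F ∷ []) , (π201 ∷ π210 ∷ π102 ∷ π021 ∷ []))
  ∷ ((1F ∷ 2F ∷ 3F ∷ 0F ∷ []) , (π021 ∷ π120 ∷ π102 ∷ π012 ∷ []))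
  ∷ ((1F ∷ 3F ∷ 2F ∷ 0F ∷ []) , (π021 ∷ π201 ∷ π210 ∷ π012 ∷ []))
  ∷ ((1F ∷ 2F ∷ 3F ∷ 0F ∷ []) , (π102 ∷ π201 ∷ π021 ∷ π012 ∷ []))
  ∷ []

reps₅ : List (List (Word 5))
reps₅ =
  ((0F ∷ 0F ∷ 1F ∷ 2F ∷ 2F ∷ []) ∷ (0F ∷ 1F ∷ 2F ∷ 1F ∷ 2F ∷ []) ∷ (0F ∷ 2F ∷ 0F ∷ 0F ∷ 2F ∷ []) ∷ (1F ∷ 0F ∷ 0F ∷ 1F ∷ 2F ∷ []) ∷ (1F ∷ 1F ∷ 1F ∷ 0F ∷ 0F ∷ []) ∷ (1F ∷ 1F ∷ 1F ∷ 0F ∷ 1F ∷ []) ∷ (1F ∷ 2F ∷ 2F ∷ 2F ∷ 2F ∷ []) ∷ (2F ∷ 0F ∷ 2F ∷ 0F ∷ 2F ∷ []) ∷ (2F ∷ 1F ∷ 0F ∷ 2F ∷ 2F ∷ []) ∷ (2F ∷ 2F ∷ 1F ∷ 1F ∷ 2F ∷ []) ∷ [])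
  ∷ ((0F ∷ 0F ∷ 1F ∷ 2F ∷ 0F ∷ []) ∷ (0F ∷ 1F ∷ 2F ∷ 1F ∷ 0F ∷ []) ∷ (0F ∷ 2F ∷ 0F ∷ 0F ∷ 0F ∷ []) ∷ (1F ∷ 0F ∷ 0F ∷ 1F ∷ 2F ∷ []) ∷ (1F ∷ 1F ∷ 1F ∷ 0F ∷ 0F ∷ []) ∷ (1F ∷ 2F ∷ 2F ∷ 2F ∷ 2F ∷ []) ∷ (2F ∷ 0F ∷ 2F ∷ 0F ∷ 2F ∷ []) ∷ (2F ∷ 1F ∷ 0F ∷ 2F ∷ 2F ∷ []) ∷ (2F ∷ 1F ∷ 1F ∷ 0F ∷ 1F ∷ []) ∷ (2F ∷ 2F ∷ 1F ∷ 1F ∷ 2F ∷ []) ∷ [])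
  ∷ ((0F ∷ 0F ∷ 2F ∷ 2F ∷ 1F ∷ []) ∷ (0F ∷ 1F ∷ 1F ∷ 0F ∷ 2F ∷ []) ∷ (1F ∷ 0F ∷ 0F ∷ 0F ∷ 1F ∷ []) ∷ (1F ∷ 0F ∷ 2F ∷ 1F ∷ 1F ∷ []) ∷ (1F ∷ 1F ∷ 1F ∷ 0F ∷ 0F ∷ []) ∷ (1F ∷ 2F ∷ 1F ∷ 0F ∷ 1F ∷ []) ∷ (2F ∷ 0F ∷ 2F ∷ 2F ∷ 0F ∷ []) ∷ (2F ∷ 1F ∷ 0F ∷ 2F ∷ 2F ∷ []) ∷ (2F ∷ 1F ∷ 1F ∷ 1F ∷ 2F ∷ []) ∷ (2F ∷ 2F ∷ 2F ∷ 2F ∷ 2F ∷ []) ∷ [])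
  ∷ ((0F ∷ 0F ∷ 1F ∷ 0F ∷ 2F ∷ []) ∷ (0F ∷ 1F ∷ 2F ∷ 2F ∷ 1F ∷ []) ∷ (1F ∷ 0F ∷ 0F ∷ 0F ∷ 1F ∷ []) ∷ (1F ∷ 0F ∷ 2F ∷ 1F ∷ 1F ∷ []) ∷ (1F ∷ 1F ∷ 1F ∷ 0F ∷ 0F ∷ []) ∷ (1F ∷ 2F ∷ 2F ∷ 2F ∷ 2F ∷ []) ∷ (2F ∷ 0F ∷ 2F ∷ 2F ∷ 0F ∷ []) ∷ (2F ∷ 1F ∷ 0F ∷ 2F ∷ 2F ∷ []) ∷ (2F ∷ 1F ∷ 1F ∷ 1F ∷ 2F ∷ []) ∷ (2F ∷ 2F ∷ 1F ∷ 0F ∷ 1F ∷ []) ∷ [])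
  ∷ ((0F ∷ 0F ∷ 1F ∷ 2F ∷ 2F ∷ []) ∷ (0F ∷ 1F ∷ 2F ∷ 0F ∷ 1F ∷ []) ∷ (0F ∷ 2F ∷ 0F ∷ 2F ∷ 0F ∷ []) ∷ (1F ∷ 0F ∷ 0F ∷ 0F ∷ 1F ∷ []) ∷ (1F ∷ 1F ∷ 1F ∷ 0F ∷ 0F ∷ []) ∷ (1F ∷ 1F ∷ 1F ∷ 1F ∷ 2F ∷ []) ∷ (1F ∷ 2F ∷ 2F ∷ 2F ∷ 2F ∷ []) ∷ (2F ∷ 0F ∷ 2F ∷ 1F ∷ 1F ∷ []) ∷ (2F ∷ 1F ∷ 0F ∷ 2F ∷ 2F ∷ []) ∷ (2F ∷ 2F ∷ 1F ∷ 0F ∷ 1F ∷ []) ∷ [])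
  ∷ []
certs₅ : List (Symmetry 5)
certs₅ =
  ((0F ∷ 1F ∷ 2F ∷ 3F ∷ 4F ∷ []) , (π012 ∷ π012 ∷ π012 ∷ π012 ∷ π012 ∷ []))
  ∷ ((0F ∷ 1F ∷ 2F ∷ 3F ∷ 4F ∷ []) , (π012 ∷ π012 ∷ π012 ∷ π012 ∷ π012 ∷ []))
  ∷ ((0F ∷ 1F ∷ 2F ∷ 3F ∷ 4F ∷ []) , (π012 ∷ π012 ∷ π012 ∷ π012 ∷ π102 ∷ []))
  ∷ ((0F ∷ 1F ∷ 2F ∷ 3F ∷ 4F ∷ []) , (π021 ∷ π012 ∷ π012 ∷ π012 ∷ π102 ∷ []))
  ∷ ((0F ∷ 1F ∷ 2F ∷ 3F ∷ 4F ∷ []) , (π021 ∷ π012 ∷ π012 ∷ π012 ∷ π012 ∷ []))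
  ∷ ((0F ∷ 1F ∷ 2F ∷ 3F ∷ 4F ∷ []) , (π021 ∷ π012 ∷ π012 ∷ π012 ∷ π012 ∷ []))
  ∷ ((0F ∷ 1F ∷ 2F ∷ 3F ∷ 4F ∷ []) , (π012 ∷ π012 ∷ π012 ∷ π012 ∷ π012 ∷ []))
  ∷ ((0F ∷ 1F ∷ 2F ∷ 3F ∷ 4F ∷ []) , (π012 ∷ π012 ∷ π012 ∷ π012 ∷ π012 ∷ []))
  ∷ ((0F ∷ 2F ∷ 3F ∷ 4F ∷ 1F ∷ []) , (π012 ∷ π210 ∷ π102 ∷ π102 ∷ π120 ∷ []))
  ∷ ((0F ∷ 3F ∷ 4F ∷ 1F ∷ 2F ∷ []) , (π012 ∷ π120 ∷ π012 ∷ π021 ∷ π021 ∷ []))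
  ∷ ((0F ∷ 1F ∷ 4F ∷ 3F ∷ 2F ∷ []) , (π012 ∷ π102 ∷ π012 ∷ π012 ∷ π012 ∷ []))
  ∷ ((3F ∷ 0F ∷ 2F ∷ 1F ∷ 4F ∷ []) , (π210 ∷ π012 ∷ π012 ∷ π201 ∷ π120 ∷ []))
  ∷ ((0F ∷ 1F ∷ 2F ∷ 3F ∷ 4F ∷ []) , (π012 ∷ π012 ∷ π012 ∷ π012 ∷ π012 ∷ []))
  ∷ ((0F ∷ 1F ∷ 4F ∷ 3F ∷ 2F ∷ []) , (π012 ∷ π102 ∷ π012 ∷ π012 ∷ π012 ∷ []))
  ∷ ((0F ∷ 3F ∷ 2F ∷ 1F ∷ 4F ∷ []) , (π012 ∷ π021 ∷ π021 ∷ π021 ∷ π012 ∷ []))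
  ∷ ((0F ∷ 3F ∷ 2F ∷ 1F ∷ 4F ∷ []) , (π021 ∷ π120 ∷ π012 ∷ π201 ∷ π021 ∷ []))
  ∷ ((1F ∷ 0F ∷ 2F ∷ 3F ∷ 4F ∷ []) , (π021 ∷ π021 ∷ π012 ∷ π012 ∷ π102 ∷ []))
  ∷ ((0F ∷ 2F ∷ 1F ∷ 4F ∷ 3F ∷ []) , (π012 ∷ π210 ∷ π210 ∷ π120 ∷ π201 ∷ []))
  ∷ ((0F ∷ 3F ∷ 2F ∷ 1F ∷ 4F ∷ []) , (π012 ∷ π120 ∷ π012 ∷ π201 ∷ π021 ∷ []))
  ∷ ((1F ∷ 0F ∷ 2F ∷ 3F ∷ 4F ∷ []) , (π021 ∷ π012 ∷ π012 ∷ π012 ∷ π102 ∷ []))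
  ∷ ((0F ∷ 2F ∷ 1F ∷ 4F ∷ 3F ∷ []) , (π012 ∷ π201 ∷ π120 ∷ π102 ∷ π102 ∷ []))
  ∷ ((0F ∷ 3F ∷ 2F ∷ 1F ∷ 4F ∷ []) , (π012 ∷ π120 ∷ π012 ∷ π201 ∷ π021 ∷ []))
  ∷ ((3F ∷ 0F ∷ 2F ∷ 1F ∷ 4F ∷ []) , (π210 ∷ π021 ∷ π012 ∷ π201 ∷ π120 ∷ []))
  ∷ ((0F ∷ 1F ∷ 2F ∷ 3F ∷ 4F ∷ []) , (π021 ∷ π012 ∷ π012 ∷ π012 ∷ π012 ∷ []))
  ∷ ((0F ∷ 1F ∷ 4F ∷ 3F ∷ 2F ∷ []) , (π012 ∷ π012 ∷ π021 ∷ π210 ∷ π021 ∷ []))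
  ∷ ((0F ∷ 1F ∷ 4F ∷ 3F ∷ 2F ∷ []) , (π012 ∷ π012 ∷ π021 ∷ π210 ∷ π021 ∷ []))
  ∷ ((0F ∷ 3F ∷ 4F ∷ 1F ∷ 2F ∷ []) , (π012 ∷ π021 ∷ π021 ∷ π201 ∷ π012 ∷ []))
  ∷ ((0F ∷ 2F ∷ 3F ∷ 4F ∷ 1F ∷ []) , (π012 ∷ π201 ∷ π201 ∷ π120 ∷ π210 ∷ []))
  ∷ ((0F ∷ 1F ∷ 2F ∷ 3F ∷ 4F ∷ []) , (π012 ∷ π102 ∷ π021 ∷ π210 ∷ π021 ∷ []))
  ∷ ((0F ∷ 1F ∷ 2F ∷ 3F ∷ 4F ∷ []) , (π012 ∷ π102 ∷ π021 ∷ π210 ∷ π021 ∷ []))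
  ∷ ((1F ∷ 2F ∷ 3F ∷ 4F ∷ 0F ∷ []) , (π102 ∷ π021 ∷ π012 ∷ π021 ∷ π021 ∷ []))
  ∷ ((1F ∷ 2F ∷ 3F ∷ 4F ∷ 0F ∷ []) , (π021 ∷ π102 ∷ π201 ∷ π021 ∷ π021 ∷ []))
  ∷ ((1F ∷ 2F ∷ 3F ∷ 4F ∷ 0F ∷ []) , (π021 ∷ π021 ∷ π120 ∷ π102 ∷ π021 ∷ []))
  ∷ ((1F ∷ 2F ∷ 4F ∷ 3F ∷ 0F ∷ []) , (π021 ∷ π012 ∷ π021 ∷ π201 ∷ π021 ∷ []))
  ∷ ((1F ∷ 2F ∷ 4F ∷ 3F ∷ 0F ∷ []) , (π120 ∷ π021 ∷ π120 ∷ π102 ∷ π120 ∷ []))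
  ∷ ((1F ∷ 2F ∷ 4F ∷ 3F ∷ 0F ∷ []) , (π012 ∷ π021 ∷ π201 ∷ π210 ∷ π021 ∷ []))
  ∷ ((2F ∷ 1F ∷ 4F ∷ 3F ∷ 0F ∷ []) , (π120 ∷ π021 ∷ π120 ∷ π120 ∷ π120 ∷ []))
  ∷ ((1F ∷ 2F ∷ 3F ∷ 4F ∷ 0F ∷ []) , (π210 ∷ π021 ∷ π201 ∷ π210 ∷ π120 ∷ []))
  ∷ ((2F ∷ 1F ∷ 3F ∷ 4F ∷ 0F ∷ []) , (π210 ∷ π021 ∷ π210 ∷ π210 ∷ π120 ∷ []))
  ∷ ((1F ∷ 2F ∷ 3F ∷ 4F ∷ 0F ∷ []) , (π012 ∷ π012 ∷ π102 ∷ π012 ∷ π021 ∷ []))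
  ∷ ((4F ∷ 1F ∷ 2F ∷ 3F ∷ 0F ∷ []) , (π012 ∷ π021 ∷ π201 ∷ π021 ∷ π120 ∷ []))
  ∷ ((4F ∷ 1F ∷ 3F ∷ 2F ∷ 0F ∷ []) , (π021 ∷ π021 ∷ π012 ∷ π102 ∷ π120 ∷ []))
  ∷ ((1F ∷ 2F ∷ 4F ∷ 3F ∷ 0F ∷ []) , (π210 ∷ π012 ∷ π102 ∷ π012 ∷ π120 ∷ []))
  ∷ ((4F ∷ 1F ∷ 2F ∷ 3F ∷ 0F ∷ []) , (π021 ∷ π012 ∷ π021 ∷ π120 ∷ π120 ∷ []))
  ∷ ((2F ∷ 1F ∷ 4F ∷ 3F ∷ 0F ∷ []) , (π210 ∷ π012 ∷ π102 ∷ π021 ∷ π120 ∷ []))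
  ∷ ((4F ∷ 1F ∷ 2F ∷ 3F ∷ 0F ∷ []) , (π201 ∷ π102 ∷ π120 ∷ π021 ∷ π102 ∷ []))
  ∷ ((2F ∷ 1F ∷ 4F ∷ 3F ∷ 0F ∷ []) , (π012 ∷ π102 ∷ π012 ∷ π120 ∷ π102 ∷ []))
  ∷ ((1F ∷ 2F ∷ 4F ∷ 3F ∷ 0F ∷ []) , (π012 ∷ π102 ∷ π012 ∷ π102 ∷ π102 ∷ []))
  ∷ ((1F ∷ 2F ∷ 4F ∷ 3F ∷ 0F ∷ []) , (π012 ∷ π102 ∷ π012 ∷ π102 ∷ π021 ∷ []))
  ∷ ((3F ∷ 1F ∷ 4F ∷ 2F ∷ 0F ∷ []) , (π201 ∷ π021 ∷ π102 ∷ π012 ∷ π120 ∷ []))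
  ∷ ((1F ∷ 2F ∷ 3F ∷ 4F ∷ 0F ∷ []) , (π210 ∷ π102 ∷ π012 ∷ π102 ∷ π120 ∷ []))
  ∷ ((3F ∷ 1F ∷ 2F ∷ 4F ∷ 0F ∷ []) , (π102 ∷ π021 ∷ π021 ∷ π201 ∷ π120 ∷ []))
  ∷ ((1F ∷ 3F ∷ 0F ∷ 2F ∷ 4F ∷ []) , (π120 ∷ π012 ∷ π021 ∷ π120 ∷ π021 ∷ []))
  ∷ ((1F ∷ 3F ∷ 4F ∷ 0F ∷ 2F ∷ []) , (π102 ∷ π120 ∷ π201 ∷ π102 ∷ π012 ∷ []))
  ∷ ((2F ∷ 1F ∷ 3F ∷ 4F ∷ 0F ∷ []) , (π102 ∷ π102 ∷ π102 ∷ π210 ∷ π102 ∷ []))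
  ∷ ((1F ∷ 3F ∷ 4F ∷ 0F ∷ 2F ∷ []) , (π012 ∷ π210 ∷ π210 ∷ π120 ∷ π021 ∷ []))
  ∷ ((2F ∷ 1F ∷ 3F ∷ 4F ∷ 0F ∷ []) , (π120 ∷ π012 ∷ π012 ∷ π201 ∷ π120 ∷ []))
  ∷ ((1F ∷ 2F ∷ 0F ∷ 3F ∷ 4F ∷ []) , (π120 ∷ π201 ∷ π021 ∷ π201 ∷ π012 ∷ []))
  ∷ ((1F ∷ 2F ∷ 4F ∷ 0F ∷ 3F ∷ []) , (π102 ∷ π012 ∷ π210 ∷ π102 ∷ π120 ∷ []))
  ∷ ((3F ∷ 1F ∷ 2F ∷ 4F ∷ 0F ∷ []) , (π021 ∷ π102 ∷ π210 ∷ π201 ∷ π102 ∷ []))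
  ∷ ((1F ∷ 2F ∷ 4F ∷ 0F ∷ 3F ∷ []) , (π012 ∷ π021 ∷ π201 ∷ π120 ∷ π210 ∷ []))
  ∷ ((3F ∷ 1F ∷ 2F ∷ 4F ∷ 0F ∷ []) , (π201 ∷ π012 ∷ π201 ∷ π210 ∷ π120 ∷ []))
  ∷ ((1F ∷ 2F ∷ 3F ∷ 4F ∷ 0F ∷ []) , (π012 ∷ π012 ∷ π102 ∷ π012 ∷ π102 ∷ []))
  ∷ ((4F ∷ 1F ∷ 3F ∷ 2F ∷ 0F ∷ []) , (π012 ∷ π012 ∷ π210 ∷ π012 ∷ π120 ∷ []))
  ∷ ((4F ∷ 1F ∷ 3F ∷ 2F ∷ 0F ∷ []) , (π210 ∷ π102 ∷ π201 ∷ π102 ∷ π102 ∷ []))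
  ∷ ((3F ∷ 1F ∷ 4F ∷ 2F ∷ 0F ∷ []) , (π102 ∷ π012 ∷ π120 ∷ π102 ∷ π120 ∷ []))
  ∷ ((3F ∷ 1F ∷ 4F ∷ 2F ∷ 0F ∷ []) , (π120 ∷ π102 ∷ π021 ∷ π012 ∷ π102 ∷ []))
  ∷ ((1F ∷ 2F ∷ 4F ∷ 3F ∷ 0F ∷ []) , (π012 ∷ π021 ∷ π201 ∷ π210 ∷ π102 ∷ []))
  ∷ ((1F ∷ 2F ∷ 4F ∷ 3F ∷ 0F ∷ []) , (π201 ∷ π102 ∷ π120 ∷ π210 ∷ π120 ∷ []))
  ∷ ((1F ∷ 2F ∷ 3F ∷ 4F ∷ 0F ∷ []) , (π102 ∷ π021 ∷ π012 ∷ π021 ∷ π120 ∷ []))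
  ∷ ((2F ∷ 3F ∷ 4F ∷ 1F ∷ 0F ∷ []) , (π012 ∷ π012 ∷ π021 ∷ π201 ∷ π021 ∷ []))
  ∷ ((2F ∷ 3F ∷ 4F ∷ 1F ∷ 0F ∷ []) , (π021 ∷ π102 ∷ π012 ∷ π021 ∷ π012 ∷ []))
  ∷ ((2F ∷ 3F ∷ 0F ∷ 1F ∷ 4F ∷ []) , (π012 ∷ π102 ∷ π021 ∷ π201 ∷ π021 ∷ []))
  ∷ ((1F ∷ 2F ∷ 4F ∷ 3F ∷ 0F ∷ []) , (π201 ∷ π021 ∷ π012 ∷ π021 ∷ π120 ∷ []))
  ∷ ((1F ∷ 2F ∷ 4F ∷ 3F ∷ 0F ∷ []) , (π021 ∷ π012 ∷ π021 ∷ π201 ∷ π102 ∷ []))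
  ∷ ((2F ∷ 4F ∷ 3F ∷ 1F ∷ 0F ∷ []) , (π021 ∷ π210 ∷ π120 ∷ π201 ∷ π021 ∷ []))
  ∷ ((2F ∷ 4F ∷ 3F ∷ 1F ∷ 0F ∷ []) , (π012 ∷ π201 ∷ π210 ∷ π021 ∷ π012 ∷ []))
  ∷ ((2F ∷ 3F ∷ 1F ∷ 0F ∷ 4F ∷ []) , (π012 ∷ π102 ∷ π210 ∷ π120 ∷ π021 ∷ []))
  ∷ ((1F ∷ 2F ∷ 3F ∷ 4F ∷ 0F ∷ []) , (π201 ∷ π012 ∷ π210 ∷ π120 ∷ π120 ∷ []))
  ∷ ((1F ∷ 2F ∷ 3F ∷ 4F ∷ 0F ∷ []) , (π021 ∷ π021 ∷ π120 ∷ π102 ∷ π102 ∷ []))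
  ∷ ((1F ∷ 2F ∷ 3F ∷ 4F ∷ 0F ∷ []) , (π021 ∷ π102 ∷ π201 ∷ π021 ∷ π102 ∷ []))
  ∷ ((1F ∷ 2F ∷ 4F ∷ 3F ∷ 0F ∷ []) , (π102 ∷ π012 ∷ π210 ∷ π120 ∷ π021 ∷ []))
  ∷ ((2F ∷ 3F ∷ 0F ∷ 1F ∷ 4F ∷ []) , (π120 ∷ π021 ∷ π021 ∷ π120 ∷ π021 ∷ []))
  ∷ ((2F ∷ 3F ∷ 4F ∷ 0F ∷ 1F ∷ []) , (π012 ∷ π201 ∷ π210 ∷ π120 ∷ π021 ∷ []))
  ∷ ((1F ∷ 2F ∷ 3F ∷ 4F ∷ 0F ∷ []) , (π120 ∷ π012 ∷ π021 ∷ π201 ∷ π120 ∷ []))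
  ∷ ((2F ∷ 3F ∷ 4F ∷ 0F ∷ 1F ∷ []) , (π102 ∷ π102 ∷ π201 ∷ π102 ∷ π012 ∷ []))
  ∷ ((1F ∷ 2F ∷ 3F ∷ 4F ∷ 0F ∷ []) , (π102 ∷ π102 ∷ π120 ∷ π210 ∷ π102 ∷ []))
  ∷ ((3F ∷ 1F ∷ 2F ∷ 4F ∷ 0F ∷ []) , (π210 ∷ π102 ∷ π021 ∷ π012 ∷ π120 ∷ []))
  ∷ ((2F ∷ 1F ∷ 3F ∷ 4F ∷ 0F ∷ []) , (π210 ∷ π102 ∷ π021 ∷ π102 ∷ π120 ∷ []))
  ∷ ((3F ∷ 1F ∷ 4F ∷ 2F ∷ 0F ∷ []) , (π120 ∷ π021 ∷ π210 ∷ π120 ∷ π120 ∷ []))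
  ∷ ((1F ∷ 4F ∷ 2F ∷ 3F ∷ 0F ∷ []) , (π012 ∷ π210 ∷ π120 ∷ π210 ∷ π021 ∷ []))
  ∷ ((1F ∷ 4F ∷ 2F ∷ 3F ∷ 0F ∷ []) , (π021 ∷ π201 ∷ π210 ∷ π012 ∷ π012 ∷ []))
  ∷ ((1F ∷ 2F ∷ 3F ∷ 0F ∷ 4F ∷ []) , (π012 ∷ π012 ∷ π102 ∷ π102 ∷ π012 ∷ []))
  ∷ ((3F ∷ 1F ∷ 2F ∷ 4F ∷ 0F ∷ []) , (π012 ∷ π012 ∷ π120 ∷ π102 ∷ π102 ∷ []))
  ∷ ((3F ∷ 1F ∷ 2F ∷ 4F ∷ 0F ∷ []) , (π210 ∷ π021 ∷ π210 ∷ π120 ∷ π120 ∷ []))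
  ∷ ((2F ∷ 1F ∷ 3F ∷ 4F ∷ 0F ∷ []) , (π012 ∷ π012 ∷ π120 ∷ π012 ∷ π102 ∷ []))
  ∷ ((4F ∷ 1F ∷ 2F ∷ 3F ∷ 0F ∷ []) , (π012 ∷ π102 ∷ π012 ∷ π210 ∷ π120 ∷ []))
  ∷ ((4F ∷ 1F ∷ 2F ∷ 3F ∷ 0F ∷ []) , (π210 ∷ π012 ∷ π102 ∷ π201 ∷ π102 ∷ []))
  ∷ ((2F ∷ 1F ∷ 4F ∷ 3F ∷ 0F ∷ []) , (π201 ∷ π102 ∷ π120 ∷ π201 ∷ π120 ∷ []))
  ∷ ((2F ∷ 1F ∷ 3F ∷ 4F ∷ 0F ∷ []) , (π102 ∷ π021 ∷ π021 ∷ π021 ∷ π120 ∷ []))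
  ∷ ((1F ∷ 3F ∷ 4F ∷ 2F ∷ 0F ∷ []) , (π012 ∷ π021 ∷ π021 ∷ π201 ∷ π021 ∷ []))
  ∷ ((1F ∷ 3F ∷ 4F ∷ 2F ∷ 0F ∷ []) , (π021 ∷ π120 ∷ π012 ∷ π021 ∷ π012 ∷ []))
  ∷ ((1F ∷ 3F ∷ 0F ∷ 2F ∷ 4F ∷ []) , (π012 ∷ π120 ∷ π021 ∷ π201 ∷ π021 ∷ []))
  ∷ ((2F ∷ 1F ∷ 4F ∷ 3F ∷ 0F ∷ []) , (π021 ∷ π012 ∷ π021 ∷ π210 ∷ π102 ∷ []))
  ∷ ((2F ∷ 1F ∷ 4F ∷ 3F ∷ 0F ∷ []) , (π201 ∷ π021 ∷ π012 ∷ π012 ∷ π120 ∷ []))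
  ∷ ((3F ∷ 1F ∷ 2F ∷ 4F ∷ 0F ∷ []) , (π120 ∷ π012 ∷ π012 ∷ π021 ∷ π120 ∷ []))
  ∷ ((3F ∷ 1F ∷ 2F ∷ 4F ∷ 0F ∷ []) , (π102 ∷ π102 ∷ π102 ∷ π120 ∷ π102 ∷ []))
  ∷ ((2F ∷ 1F ∷ 4F ∷ 3F ∷ 0F ∷ []) , (π012 ∷ π021 ∷ π201 ∷ π201 ∷ π102 ∷ []))
  ∷ ((1F ∷ 4F ∷ 3F ∷ 2F ∷ 0F ∷ []) , (π021 ∷ π210 ∷ π102 ∷ π201 ∷ π021 ∷ []))
  ∷ ((1F ∷ 4F ∷ 3F ∷ 2F ∷ 0F ∷ []) , (π012 ∷ π201 ∷ π201 ∷ π021 ∷ π012 ∷ []))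
  ∷ ((1F ∷ 3F ∷ 2F ∷ 0F ∷ 4F ∷ []) , (π012 ∷ π120 ∷ π210 ∷ π120 ∷ π021 ∷ []))
  ∷ ((2F ∷ 1F ∷ 3F ∷ 4F ∷ 0F ∷ []) , (π201 ∷ π012 ∷ π201 ∷ π120 ∷ π120 ∷ []))
  ∷ ((2F ∷ 1F ∷ 3F ∷ 4F ∷ 0F ∷ []) , (π021 ∷ π021 ∷ π102 ∷ π102 ∷ π102 ∷ []))
  ∷ ((2F ∷ 1F ∷ 3F ∷ 4F ∷ 0F ∷ []) , (π021 ∷ π102 ∷ π210 ∷ π021 ∷ π102 ∷ []))
  ∷ ((1F ∷ 2F ∷ 3F ∷ 4F ∷ 0F ∷ []) , (π021 ∷ π102 ∷ π201 ∷ π120 ∷ π012 ∷ []))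
  ∷ ((0F ∷ 1F ∷ 2F ∷ 3F ∷ 4F ∷ []) , (π120 ∷ π012 ∷ π210 ∷ π012 ∷ π102 ∷ []))
  ∷ ((1F ∷ 2F ∷ 4F ∷ 0F ∷ 3F ∷ []) , (π120 ∷ π210 ∷ π012 ∷ π120 ∷ π210 ∷ []))
  ∷ ((1F ∷ 2F ∷ 3F ∷ 4F ∷ 0F ∷ []) , (π012 ∷ π012 ∷ π102 ∷ π102 ∷ π021 ∷ []))
  ∷ ((1F ∷ 3F ∷ 2F ∷ 0F ∷ 4F ∷ []) , (π102 ∷ π210 ∷ π201 ∷ π120 ∷ π012 ∷ []))
  ∷ ((4F ∷ 1F ∷ 3F ∷ 2F ∷ 0F ∷ []) , (π102 ∷ π102 ∷ π012 ∷ π210 ∷ π120 ∷ []))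
  ∷ ((1F ∷ 3F ∷ 2F ∷ 0F ∷ 4F ∷ []) , (π012 ∷ π120 ∷ π210 ∷ π102 ∷ π021 ∷ []))
  ∷ ((1F ∷ 2F ∷ 0F ∷ 4F ∷ 3F ∷ []) , (π012 ∷ π102 ∷ π021 ∷ π102 ∷ π102 ∷ []))
  ∷ ((4F ∷ 1F ∷ 3F ∷ 2F ∷ 0F ∷ []) , (π120 ∷ π012 ∷ π102 ∷ π201 ∷ π102 ∷ []))
  ∷ ((4F ∷ 1F ∷ 3F ∷ 2F ∷ 0F ∷ []) , (π102 ∷ π021 ∷ π201 ∷ π021 ∷ π120 ∷ []))
  ∷ ((1F ∷ 2F ∷ 3F ∷ 0F ∷ 4F ∷ []) , (π120 ∷ π201 ∷ π210 ∷ π120 ∷ π012 ∷ []))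
  ∷ ((1F ∷ 4F ∷ 2F ∷ 0F ∷ 3F ∷ []) , (π102 ∷ π012 ∷ π210 ∷ π120 ∷ π210 ∷ []))
  ∷ ((3F ∷ 1F ∷ 4F ∷ 2F ∷ 0F ∷ []) , (π201 ∷ π102 ∷ π210 ∷ π201 ∷ π120 ∷ []))
  ∷ ((1F ∷ 4F ∷ 2F ∷ 0F ∷ 3F ∷ []) , (π012 ∷ π021 ∷ π201 ∷ π102 ∷ π120 ∷ []))
  ∷ ((3F ∷ 1F ∷ 4F ∷ 2F ∷ 0F ∷ []) , (π021 ∷ π012 ∷ π201 ∷ π210 ∷ π102 ∷ []))
  ∷ ((4F ∷ 1F ∷ 2F ∷ 3F ∷ 0F ∷ []) , (π201 ∷ π021 ∷ π012 ∷ π102 ∷ π120 ∷ []))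
  ∷ ((1F ∷ 2F ∷ 4F ∷ 3F ∷ 0F ∷ []) , (π021 ∷ π012 ∷ π021 ∷ π210 ∷ π021 ∷ []))
  ∷ ((1F ∷ 2F ∷ 4F ∷ 3F ∷ 0F ∷ []) , (π012 ∷ π102 ∷ π012 ∷ π012 ∷ π012 ∷ []))
  ∷ ((1F ∷ 2F ∷ 0F ∷ 3F ∷ 4F ∷ []) , (π012 ∷ π012 ∷ π012 ∷ π012 ∷ π012 ∷ []))
  ∷ ((3F ∷ 1F ∷ 4F ∷ 2F ∷ 0F ∷ []) , (π210 ∷ π012 ∷ π012 ∷ π021 ∷ π120 ∷ []))
  ∷ ((3F ∷ 1F ∷ 4F ∷ 2F ∷ 0F ∷ []) , (π012 ∷ π021 ∷ π021 ∷ π201 ∷ π102 ∷ []))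
  ∷ ((4F ∷ 1F ∷ 3F ∷ 2F ∷ 0F ∷ []) , (π201 ∷ π012 ∷ π021 ∷ π120 ∷ π120 ∷ []))
  ∷ ((3F ∷ 1F ∷ 4F ∷ 2F ∷ 0F ∷ []) , (π012 ∷ π102 ∷ π102 ∷ π120 ∷ π102 ∷ []))
  ∷ ((3F ∷ 1F ∷ 2F ∷ 4F ∷ 0F ∷ []) , (π021 ∷ π021 ∷ π102 ∷ π012 ∷ π102 ∷ []))
  ∷ ((4F ∷ 1F ∷ 3F ∷ 2F ∷ 0F ∷ []) , (π021 ∷ π102 ∷ π120 ∷ π021 ∷ π102 ∷ []))
  ∷ ((4F ∷ 1F ∷ 3F ∷ 2F ∷ 0F ∷ []) , (π210 ∷ π021 ∷ π120 ∷ π210 ∷ π102 ∷ []))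
  ∷ ((0F ∷ 1F ∷ 3F ∷ 2F ∷ 4F ∷ []) , (π102 ∷ π012 ∷ π102 ∷ π201 ∷ π120 ∷ []))
  ∷ ((1F ∷ 2F ∷ 0F ∷ 4F ∷ 3F ∷ []) , (π120 ∷ π210 ∷ π021 ∷ π102 ∷ π210 ∷ []))
  ∷ ((1F ∷ 3F ∷ 2F ∷ 4F ∷ 0F ∷ []) , (π012 ∷ π120 ∷ π210 ∷ π120 ∷ π012 ∷ []))
  ∷ ((1F ∷ 2F ∷ 3F ∷ 0F ∷ 4F ∷ []) , (π102 ∷ π021 ∷ π012 ∷ π102 ∷ π021 ∷ []))
  ∷ ((4F ∷ 1F ∷ 2F ∷ 3F ∷ 0F ∷ []) , (π120 ∷ π102 ∷ π201 ∷ π102 ∷ π102 ∷ []))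
  ∷ ((1F ∷ 3F ∷ 2F ∷ 4F ∷ 0F ∷ []) , (π021 ∷ π021 ∷ π120 ∷ π102 ∷ π021 ∷ []))
  ∷ ((1F ∷ 2F ∷ 3F ∷ 0F ∷ 4F ∷ []) , (π012 ∷ π012 ∷ π102 ∷ π120 ∷ π012 ∷ []))
  ∷ ((1F ∷ 2F ∷ 4F ∷ 0F ∷ 3F ∷ []) , (π012 ∷ π102 ∷ π012 ∷ π120 ∷ π102 ∷ []))
  ∷ ((4F ∷ 1F ∷ 2F ∷ 3F ∷ 0F ∷ []) , (π102 ∷ π012 ∷ π210 ∷ π012 ∷ π120 ∷ []))
  ∷ ((4F ∷ 1F ∷ 2F ∷ 3F ∷ 0F ∷ []) , (π120 ∷ π021 ∷ π120 ∷ π210 ∷ π102 ∷ []))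
  ∷ ((1F ∷ 3F ∷ 2F ∷ 0F ∷ 4F ∷ []) , (π120 ∷ π012 ∷ π021 ∷ π102 ∷ π021 ∷ []))
  ∷ ((1F ∷ 4F ∷ 3F ∷ 0F ∷ 2F ∷ []) , (π102 ∷ π021 ∷ π102 ∷ π102 ∷ π021 ∷ []))
  ∷ ((2F ∷ 1F ∷ 4F ∷ 3F ∷ 0F ∷ []) , (π120 ∷ π102 ∷ π201 ∷ π012 ∷ π102 ∷ []))
  ∷ ((1F ∷ 4F ∷ 3F ∷ 0F ∷ 2F ∷ []) , (π012 ∷ π012 ∷ π012 ∷ π120 ∷ π012 ∷ []))
  ∷ ((2F ∷ 1F ∷ 4F ∷ 3F ∷ 0F ∷ []) , (π102 ∷ π012 ∷ π210 ∷ π102 ∷ π120 ∷ []))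
  ∷ ((2F ∷ 3F ∷ 1F ∷ 0F ∷ 4F ∷ []) , (π120 ∷ π021 ∷ π021 ∷ π102 ∷ π021 ∷ []))
  ∷ ((2F ∷ 4F ∷ 3F ∷ 0F ∷ 1F ∷ []) , (π102 ∷ π021 ∷ π120 ∷ π102 ∷ π021 ∷ []))
  ∷ ((1F ∷ 2F ∷ 4F ∷ 3F ∷ 0F ∷ []) , (π120 ∷ π102 ∷ π201 ∷ π021 ∷ π102 ∷ []))
  ∷ ((2F ∷ 4F ∷ 3F ∷ 0F ∷ 1F ∷ []) , (π012 ∷ π012 ∷ π021 ∷ π120 ∷ π012 ∷ []))
  ∷ ((1F ∷ 2F ∷ 4F ∷ 3F ∷ 0F ∷ []) , (π102 ∷ π012 ∷ π210 ∷ π120 ∷ π120 ∷ []))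
  ∷ ((1F ∷ 2F ∷ 3F ∷ 4F ∷ 0F ∷ []) , (π102 ∷ π102 ∷ π120 ∷ π210 ∷ π012 ∷ []))
  ∷ ((1F ∷ 2F ∷ 3F ∷ 4F ∷ 0F ∷ []) , (π102 ∷ π102 ∷ π120 ∷ π210 ∷ π021 ∷ []))
  ∷ ((2F ∷ 3F ∷ 1F ∷ 0F ∷ 4F ∷ []) , (π120 ∷ π021 ∷ π021 ∷ π120 ∷ π021 ∷ []))
  ∷ ((2F ∷ 4F ∷ 3F ∷ 0F ∷ 1F ∷ []) , (π102 ∷ π021 ∷ π120 ∷ π120 ∷ π021 ∷ []))
  ∷ ((1F ∷ 2F ∷ 4F ∷ 3F ∷ 0F ∷ []) , (π120 ∷ π102 ∷ π201 ∷ π021 ∷ π120 ∷ []))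
  ∷ ((2F ∷ 4F ∷ 3F ∷ 0F ∷ 1F ∷ []) , (π012 ∷ π012 ∷ π021 ∷ π102 ∷ π012 ∷ []))
  ∷ ((1F ∷ 2F ∷ 4F ∷ 3F ∷ 0F ∷ []) , (π102 ∷ π012 ∷ π210 ∷ π120 ∷ π102 ∷ []))
  ∷ ((1F ∷ 3F ∷ 2F ∷ 0F ∷ 4F ∷ []) , (π120 ∷ π012 ∷ π021 ∷ π120 ∷ π021 ∷ []))
  ∷ ((1F ∷ 4F ∷ 3F ∷ 0F ∷ 2F ∷ []) , (π102 ∷ π021 ∷ π102 ∷ π120 ∷ π021 ∷ []))
  ∷ ((2F ∷ 1F ∷ 4F ∷ 3F ∷ 0F ∷ []) , (π120 ∷ π102 ∷ π201 ∷ π012 ∷ π120 ∷ []))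
  ∷ ((1F ∷ 4F ∷ 3F ∷ 0F ∷ 2F ∷ []) , (π012 ∷ π012 ∷ π012 ∷ π102 ∷ π012 ∷ []))
  ∷ ((2F ∷ 1F ∷ 4F ∷ 3F ∷ 0F ∷ []) , (π102 ∷ π012 ∷ π210 ∷ π102 ∷ π102 ∷ []))
  ∷ ((0F ∷ 1F ∷ 3F ∷ 2F ∷ 4F ∷ []) , (π120 ∷ π012 ∷ π102 ∷ π201 ∷ π120 ∷ []))
  ∷ ((1F ∷ 2F ∷ 0F ∷ 4F ∷ 3F ∷ []) , (π120 ∷ π210 ∷ π012 ∷ π102 ∷ π210 ∷ []))
  ∷ ((1F ∷ 3F ∷ 2F ∷ 4F ∷ 0F ∷ []) , (π012 ∷ π120 ∷ π210 ∷ π120 ∷ π021 ∷ []))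
  ∷ ((1F ∷ 2F ∷ 3F ∷ 0F ∷ 4F ∷ []) , (π102 ∷ π021 ∷ π012 ∷ π120 ∷ π021 ∷ []))
  ∷ ((4F ∷ 1F ∷ 2F ∷ 3F ∷ 0F ∷ []) , (π120 ∷ π102 ∷ π201 ∷ π102 ∷ π120 ∷ []))
  ∷ ((1F ∷ 3F ∷ 2F ∷ 4F ∷ 0F ∷ []) , (π021 ∷ π021 ∷ π120 ∷ π102 ∷ π012 ∷ []))
  ∷ ((1F ∷ 2F ∷ 3F ∷ 0F ∷ 4F ∷ []) , (π012 ∷ π012 ∷ π102 ∷ π102 ∷ π012 ∷ []))
  ∷ ((1F ∷ 2F ∷ 4F ∷ 0F ∷ 3F ∷ []) , (π012 ∷ π102 ∷ π012 ∷ π102 ∷ π102 ∷ []))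
  ∷ ((4F ∷ 1F ∷ 2F ∷ 3F ∷ 0F ∷ []) , (π102 ∷ π012 ∷ π210 ∷ π012 ∷ π102 ∷ []))
  ∷ ((4F ∷ 1F ∷ 2F ∷ 3F ∷ 0F ∷ []) , (π120 ∷ π021 ∷ π120 ∷ π210 ∷ π120 ∷ []))
  ∷ ((4F ∷ 1F ∷ 3F ∷ 2F ∷ 0F ∷ []) , (π210 ∷ π021 ∷ π120 ∷ π210 ∷ π120 ∷ []))
  ∷ ((4F ∷ 1F ∷ 3F ∷ 2F ∷ 0F ∷ []) , (π021 ∷ π102 ∷ π120 ∷ π021 ∷ π120 ∷ []))
  ∷ ((3F ∷ 1F ∷ 4F ∷ 2F ∷ 0F ∷ []) , (π012 ∷ π102 ∷ π102 ∷ π120 ∷ π120 ∷ []))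
  ∷ ((3F ∷ 1F ∷ 2F ∷ 4F ∷ 0F ∷ []) , (π021 ∷ π021 ∷ π102 ∷ π012 ∷ π120 ∷ []))
  ∷ ((4F ∷ 1F ∷ 3F ∷ 2F ∷ 0F ∷ []) , (π201 ∷ π012 ∷ π021 ∷ π120 ∷ π102 ∷ []))
  ∷ ((1F ∷ 2F ∷ 4F ∷ 3F ∷ 0F ∷ []) , (π021 ∷ π012 ∷ π021 ∷ π210 ∷ π012 ∷ []))
  ∷ ((1F ∷ 2F ∷ 4F ∷ 3F ∷ 0F ∷ []) , (π012 ∷ π102 ∷ π012 ∷ π012 ∷ π021 ∷ []))
  ∷ ((1F ∷ 2F ∷ 0F ∷ 3F ∷ 4F ∷ []) , (π012 ∷ π012 ∷ π021 ∷ π012 ∷ π012 ∷ []))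
  ∷ ((3F ∷ 1F ∷ 4F ∷ 2F ∷ 0F ∷ []) , (π210 ∷ π012 ∷ π012 ∷ π021 ∷ π102 ∷ []))
  ∷ ((3F ∷ 1F ∷ 4F ∷ 2F ∷ 0F ∷ []) , (π012 ∷ π021 ∷ π021 ∷ π201 ∷ π120 ∷ []))
  ∷ ((4F ∷ 1F ∷ 2F ∷ 3F ∷ 0F ∷ []) , (π201 ∷ π021 ∷ π012 ∷ π102 ∷ π102 ∷ []))
  ∷ ((1F ∷ 2F ∷ 3F ∷ 0F ∷ 4F ∷ []) , (π120 ∷ π201 ∷ π210 ∷ π102 ∷ π012 ∷ []))
  ∷ ((1F ∷ 4F ∷ 2F ∷ 0F ∷ 3F ∷ []) , (π102 ∷ π012 ∷ π210 ∷ π102 ∷ π210 ∷ []))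
  ∷ ((3F ∷ 1F ∷ 4F ∷ 2F ∷ 0F ∷ []) , (π201 ∷ π102 ∷ π210 ∷ π201 ∷ π102 ∷ []))
  ∷ ((1F ∷ 4F ∷ 2F ∷ 0F ∷ 3F ∷ []) , (π012 ∷ π021 ∷ π201 ∷ π120 ∷ π120 ∷ []))
  ∷ ((3F ∷ 1F ∷ 4F ∷ 2F ∷ 0F ∷ []) , (π021 ∷ π012 ∷ π201 ∷ π210 ∷ π120 ∷ []))
  ∷ ((1F ∷ 2F ∷ 3F ∷ 4F ∷ 0F ∷ []) , (π021 ∷ π102 ∷ π201 ∷ π120 ∷ π021 ∷ []))
  ∷ ((0F ∷ 1F ∷ 2F ∷ 3F ∷ 4F ∷ []) , (π102 ∷ π012 ∷ π210 ∷ π012 ∷ π102 ∷ []))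
  ∷ ((1F ∷ 2F ∷ 4F ∷ 0F ∷ 3F ∷ []) , (π120 ∷ π210 ∷ π012 ∷ π102 ∷ π210 ∷ []))
  ∷ ((1F ∷ 2F ∷ 3F ∷ 4F ∷ 0F ∷ []) , (π012 ∷ π012 ∷ π102 ∷ π102 ∷ π012 ∷ []))
  ∷ ((1F ∷ 3F ∷ 2F ∷ 0F ∷ 4F ∷ []) , (π102 ∷ π210 ∷ π201 ∷ π102 ∷ π012 ∷ []))
  ∷ ((4F ∷ 1F ∷ 3F ∷ 2F ∷ 0F ∷ []) , (π102 ∷ π102 ∷ π012 ∷ π210 ∷ π102 ∷ []))
  ∷ ((1F ∷ 3F ∷ 2F ∷ 0F ∷ 4F ∷ []) , (π012 ∷ π120 ∷ π210 ∷ π120 ∷ π021 ∷ []))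
  ∷ ((1F ∷ 2F ∷ 0F ∷ 4F ∷ 3F ∷ []) , (π012 ∷ π102 ∷ π012 ∷ π102 ∷ π102 ∷ []))
  ∷ ((4F ∷ 1F ∷ 3F ∷ 2F ∷ 0F ∷ []) , (π120 ∷ π012 ∷ π102 ∷ π201 ∷ π120 ∷ []))
  ∷ ((4F ∷ 1F ∷ 3F ∷ 2F ∷ 0F ∷ []) , (π102 ∷ π021 ∷ π201 ∷ π021 ∷ π102 ∷ []))
  ∷ ((2F ∷ 1F ∷ 3F ∷ 4F ∷ 0F ∷ []) , (π021 ∷ π102 ∷ π210 ∷ π021 ∷ π120 ∷ []))
  ∷ ((1F ∷ 4F ∷ 3F ∷ 2F ∷ 0F ∷ []) , (π021 ∷ π210 ∷ π102 ∷ π201 ∷ π012 ∷ []))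
  ∷ ((1F ∷ 4F ∷ 3F ∷ 2F ∷ 0F ∷ []) , (π012 ∷ π201 ∷ π201 ∷ π021 ∷ π021 ∷ []))
  ∷ ((1F ∷ 3F ∷ 2F ∷ 0F ∷ 4F ∷ []) , (π012 ∷ π120 ∷ π210 ∷ π102 ∷ π021 ∷ []))
  ∷ ((2F ∷ 1F ∷ 3F ∷ 4F ∷ 0F ∷ []) , (π201 ∷ π012 ∷ π201 ∷ π120 ∷ π102 ∷ []))
  ∷ ((2F ∷ 1F ∷ 3F ∷ 4F ∷ 0F ∷ []) , (π021 ∷ π021 ∷ π102 ∷ π102 ∷ π120 ∷ []))
  ∷ ((3F ∷ 1F ∷ 2F ∷ 4F ∷ 0F ∷ []) , (π102 ∷ π102 ∷ π102 ∷ π120 ∷ π120 ∷ []))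
  ∷ ((2F ∷ 1F ∷ 4F ∷ 3F ∷ 0F ∷ []) , (π012 ∷ π021 ∷ π201 ∷ π201 ∷ π120 ∷ []))
  ∷ ((3F ∷ 1F ∷ 2F ∷ 4F ∷ 0F ∷ []) , (π120 ∷ π012 ∷ π012 ∷ π021 ∷ π102 ∷ []))
  ∷ ((1F ∷ 3F ∷ 4F ∷ 2F ∷ 0F ∷ []) , (π012 ∷ π021 ∷ π021 ∷ π201 ∷ π012 ∷ []))
  ∷ ((1F ∷ 3F ∷ 4F ∷ 2F ∷ 0F ∷ []) , (π021 ∷ π120 ∷ π012 ∷ π021 ∷ π021 ∷ []))
  ∷ ((1F ∷ 3F ∷ 0F ∷ 2F ∷ 4F ∷ []) , (π012 ∷ π120 ∷ π012 ∷ π201 ∷ π021 ∷ []))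
  ∷ ((2F ∷ 1F ∷ 4F ∷ 3F ∷ 0F ∷ []) , (π021 ∷ π012 ∷ π021 ∷ π210 ∷ π120 ∷ []))
  ∷ ((2F ∷ 1F ∷ 4F ∷ 3F ∷ 0F ∷ []) , (π201 ∷ π021 ∷ π012 ∷ π012 ∷ π102 ∷ []))
  ∷ ((2F ∷ 1F ∷ 4F ∷ 3F ∷ 0F ∷ []) , (π201 ∷ π102 ∷ π120 ∷ π201 ∷ π102 ∷ []))
  ∷ ((2F ∷ 1F ∷ 3F ∷ 4F ∷ 0F ∷ []) , (π102 ∷ π021 ∷ π021 ∷ π021 ∷ π102 ∷ []))
  ∷ ((4F ∷ 1F ∷ 2F ∷ 3F ∷ 0F ∷ []) , (π210 ∷ π012 ∷ π102 ∷ π201 ∷ π120 ∷ []))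
  ∷ ((4F ∷ 1F ∷ 2F ∷ 3F ∷ 0F ∷ []) , (π012 ∷ π102 ∷ π012 ∷ π210 ∷ π102 ∷ []))
  ∷ ((2F ∷ 1F ∷ 3F ∷ 4F ∷ 0F ∷ []) , (π012 ∷ π012 ∷ π120 ∷ π012 ∷ π120 ∷ []))
  ∷ ((1F ∷ 4F ∷ 2F ∷ 3F ∷ 0F ∷ []) , (π012 ∷ π210 ∷ π120 ∷ π210 ∷ π012 ∷ []))
  ∷ ((1F ∷ 4F ∷ 2F ∷ 3F ∷ 0F ∷ []) , (π021 ∷ π201 ∷ π210 ∷ π012 ∷ π021 ∷ []))
  ∷ ((1F ∷ 2F ∷ 3F ∷ 0F ∷ 4F ∷ []) , (π012 ∷ π012 ∷ π102 ∷ π120 ∷ π012 ∷ []))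
  ∷ ((3F ∷ 1F ∷ 2F ∷ 4F ∷ 0F ∷ []) , (π012 ∷ π012 ∷ π120 ∷ π102 ∷ π120 ∷ []))
  ∷ ((3F ∷ 1F ∷ 2F ∷ 4F ∷ 0F ∷ []) , (π210 ∷ π021 ∷ π210 ∷ π120 ∷ π102 ∷ []))
  ∷ ((2F ∷ 1F ∷ 3F ∷ 4F ∷ 0F ∷ []) , (π210 ∷ π102 ∷ π021 ∷ π102 ∷ π102 ∷ []))
  ∷ ((3F ∷ 1F ∷ 4F ∷ 2F ∷ 0F ∷ []) , (π120 ∷ π021 ∷ π210 ∷ π120 ∷ π102 ∷ []))
  ∷ ((3F ∷ 1F ∷ 2F ∷ 4F ∷ 0F ∷ []) , (π210 ∷ π102 ∷ π021 ∷ π012 ∷ π102 ∷ []))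
  ∷ ((2F ∷ 3F ∷ 0F ∷ 1F ∷ 4F ∷ []) , (π120 ∷ π021 ∷ π012 ∷ π120 ∷ π021 ∷ []))
  ∷ ((2F ∷ 3F ∷ 4F ∷ 0F ∷ 1F ∷ []) , (π012 ∷ π201 ∷ π210 ∷ π102 ∷ π021 ∷ []))
  ∷ ((1F ∷ 2F ∷ 3F ∷ 4F ∷ 0F ∷ []) , (π120 ∷ π012 ∷ π021 ∷ π201 ∷ π102 ∷ []))
  ∷ ((2F ∷ 3F ∷ 4F ∷ 0F ∷ 1F ∷ []) , (π102 ∷ π102 ∷ π201 ∷ π120 ∷ π012 ∷ []))
  ∷ ((1F ∷ 2F ∷ 3F ∷ 4F ∷ 0F ∷ []) , (π102 ∷ π102 ∷ π120 ∷ π210 ∷ π120 ∷ []))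
  ∷ ((1F ∷ 2F ∷ 4F ∷ 3F ∷ 0F ∷ []) , (π102 ∷ π012 ∷ π210 ∷ π120 ∷ π012 ∷ []))
  ∷ ((1F ∷ 2F ∷ 3F ∷ 4F ∷ 0F ∷ []) , (π021 ∷ π102 ∷ π201 ∷ π021 ∷ π120 ∷ []))
  ∷ ((2F ∷ 4F ∷ 3F ∷ 1F ∷ 0F ∷ []) , (π021 ∷ π210 ∷ π120 ∷ π201 ∷ π012 ∷ []))
  ∷ ((2F ∷ 4F ∷ 3F ∷ 1F ∷ 0F ∷ []) , (π012 ∷ π201 ∷ π210 ∷ π021 ∷ π021 ∷ []))
  ∷ ((2F ∷ 3F ∷ 1F ∷ 0F ∷ 4F ∷ []) , (π012 ∷ π102 ∷ π210 ∷ π102 ∷ π021 ∷ []))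
  ∷ ((1F ∷ 2F ∷ 3F ∷ 4F ∷ 0F ∷ []) , (π201 ∷ π012 ∷ π210 ∷ π120 ∷ π102 ∷ []))
  ∷ ((1F ∷ 2F ∷ 3F ∷ 4F ∷ 0F ∷ []) , (π021 ∷ π021 ∷ π120 ∷ π102 ∷ π120 ∷ []))
  ∷ ((2F ∷ 3F ∷ 4F ∷ 1F ∷ 0F ∷ []) , (π012 ∷ π012 ∷ π021 ∷ π201 ∷ π012 ∷ []))
  ∷ ((2F ∷ 3F ∷ 4F ∷ 1F ∷ 0F ∷ []) , (π021 ∷ π102 ∷ π012 ∷ π021 ∷ π021 ∷ []))
  ∷ ((2F ∷ 3F ∷ 0F ∷ 1F ∷ 4F ∷ []) , (π012 ∷ π102 ∷ π012 ∷ π201 ∷ π021 ∷ []))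
  ∷ ((1F ∷ 2F ∷ 4F ∷ 3F ∷ 0F ∷ []) , (π201 ∷ π021 ∷ π012 ∷ π021 ∷ π102 ∷ []))
  ∷ ((1F ∷ 2F ∷ 4F ∷ 3F ∷ 0F ∷ []) , (π021 ∷ π012 ∷ π021 ∷ π201 ∷ π120 ∷ []))
  ∷ ((1F ∷ 2F ∷ 4F ∷ 3F ∷ 0F ∷ []) , (π201 ∷ π102 ∷ π120 ∷ π210 ∷ π102 ∷ []))
  ∷ ((1F ∷ 2F ∷ 3F ∷ 4F ∷ 0F ∷ []) , (π102 ∷ π021 ∷ π012 ∷ π021 ∷ π102 ∷ []))
  ∷ ((3F ∷ 1F ∷ 4F ∷ 2F ∷ 0F ∷ []) , (π120 ∷ π102 ∷ π021 ∷ π012 ∷ π120 ∷ []))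
  ∷ ((1F ∷ 2F ∷ 4F ∷ 3F ∷ 0F ∷ []) , (π012 ∷ π021 ∷ π201 ∷ π210 ∷ π120 ∷ []))
  ∷ ((3F ∷ 1F ∷ 4F ∷ 2F ∷ 0F ∷ []) , (π102 ∷ π012 ∷ π120 ∷ π102 ∷ π102 ∷ []))
  ∷ ((4F ∷ 1F ∷ 3F ∷ 2F ∷ 0F ∷ []) , (π210 ∷ π102 ∷ π201 ∷ π102 ∷ π120 ∷ []))
  ∷ ((4F ∷ 1F ∷ 3F ∷ 2F ∷ 0F ∷ []) , (π012 ∷ π012 ∷ π210 ∷ π012 ∷ π102 ∷ []))
  ∷ ((1F ∷ 2F ∷ 3F ∷ 4F ∷ 0F ∷ []) , (π012 ∷ π012 ∷ π102 ∷ π012 ∷ π120 ∷ []))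
  ∷ ((1F ∷ 2F ∷ 0F ∷ 3F ∷ 4F ∷ []) , (π120 ∷ π201 ∷ π012 ∷ π201 ∷ π012 ∷ []))
  ∷ ((1F ∷ 2F ∷ 4F ∷ 0F ∷ 3F ∷ []) , (π102 ∷ π012 ∷ π210 ∷ π120 ∷ π120 ∷ []))
  ∷ ((3F ∷ 1F ∷ 2F ∷ 4F ∷ 0F ∷ []) , (π021 ∷ π102 ∷ π210 ∷ π201 ∷ π120 ∷ []))
  ∷ ((1F ∷ 2F ∷ 4F ∷ 0F ∷ 3F ∷ []) , (π012 ∷ π021 ∷ π201 ∷ π102 ∷ π210 ∷ []))
  ∷ ((3F ∷ 1F ∷ 2F ∷ 4F ∷ 0F ∷ []) , (π201 ∷ π012 ∷ π201 ∷ π210 ∷ π102 ∷ []))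
  ∷ ((1F ∷ 3F ∷ 0F ∷ 2F ∷ 4F ∷ []) , (π120 ∷ π012 ∷ π012 ∷ π120 ∷ π021 ∷ []))
  ∷ ((1F ∷ 3F ∷ 4F ∷ 0F ∷ 2F ∷ []) , (π102 ∷ π120 ∷ π201 ∷ π120 ∷ π012 ∷ []))
  ∷ ((2F ∷ 1F ∷ 3F ∷ 4F ∷ 0F ∷ []) , (π102 ∷ π102 ∷ π102 ∷ π210 ∷ π120 ∷ []))
  ∷ ((1F ∷ 3F ∷ 4F ∷ 0F ∷ 2F ∷ []) , (π012 ∷ π210 ∷ π210 ∷ π102 ∷ π021 ∷ []))
  ∷ ((2F ∷ 1F ∷ 3F ∷ 4F ∷ 0F ∷ []) , (π120 ∷ π012 ∷ π012 ∷ π201 ∷ π102 ∷ []))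
  ∷ ((1F ∷ 2F ∷ 3F ∷ 4F ∷ 0F ∷ []) , (π210 ∷ π102 ∷ π012 ∷ π102 ∷ π102 ∷ []))
  ∷ ((3F ∷ 1F ∷ 2F ∷ 4F ∷ 0F ∷ []) , (π102 ∷ π021 ∷ π021 ∷ π201 ∷ π102 ∷ []))
  ∷ ((3F ∷ 1F ∷ 4F ∷ 2F ∷ 0F ∷ []) , (π201 ∷ π021 ∷ π102 ∷ π012 ∷ π102 ∷ []))
  ∷ ((1F ∷ 2F ∷ 4F ∷ 3F ∷ 0F ∷ []) , (π012 ∷ π102 ∷ π012 ∷ π102 ∷ π012 ∷ []))
  ∷ ((2F ∷ 1F ∷ 4F ∷ 3F ∷ 0F ∷ []) , (π012 ∷ π102 ∷ π012 ∷ π120 ∷ π120 ∷ []))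
  ∷ ((1F ∷ 2F ∷ 4F ∷ 3F ∷ 0F ∷ []) , (π012 ∷ π102 ∷ π012 ∷ π102 ∷ π120 ∷ []))
  ∷ ((4F ∷ 1F ∷ 2F ∷ 3F ∷ 0F ∷ []) , (π201 ∷ π102 ∷ π120 ∷ π021 ∷ π120 ∷ []))
  ∷ ((2F ∷ 1F ∷ 4F ∷ 3F ∷ 0F ∷ []) , (π210 ∷ π012 ∷ π102 ∷ π021 ∷ π102 ∷ []))
  ∷ ((4F ∷ 1F ∷ 2F ∷ 3F ∷ 0F ∷ []) , (π021 ∷ π012 ∷ π021 ∷ π120 ∷ π102 ∷ []))
  ∷ ((1F ∷ 2F ∷ 4F ∷ 3F ∷ 0F ∷ []) , (π210 ∷ π012 ∷ π102 ∷ π012 ∷ π102 ∷ []))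
  ∷ ((4F ∷ 1F ∷ 3F ∷ 2F ∷ 0F ∷ []) , (π021 ∷ π021 ∷ π012 ∷ π102 ∷ π102 ∷ []))
  ∷ ((4F ∷ 1F ∷ 2F ∷ 3F ∷ 0F ∷ []) , (π012 ∷ π021 ∷ π201 ∷ π021 ∷ π102 ∷ []))
  ∷ ((1F ∷ 2F ∷ 3F ∷ 4F ∷ 0F ∷ []) , (π012 ∷ π012 ∷ π102 ∷ π012 ∷ π012 ∷ []))
  ∷ ((1F ∷ 2F ∷ 3F ∷ 4F ∷ 0F ∷ []) , (π210 ∷ π021 ∷ π201 ∷ π210 ∷ π102 ∷ []))
  ∷ ((2F ∷ 1F ∷ 3F ∷ 4F ∷ 0F ∷ []) , (π210 ∷ π021 ∷ π210 ∷ π210 ∷ π102 ∷ []))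
  ∷ ((2F ∷ 1F ∷ 4F ∷ 3F ∷ 0F ∷ []) , (π120 ∷ π021 ∷ π120 ∷ π120 ∷ π102 ∷ []))
  ∷ ((1F ∷ 2F ∷ 4F ∷ 3F ∷ 0F ∷ []) , (π012 ∷ π021 ∷ π201 ∷ π210 ∷ π012 ∷ []))
  ∷ ((1F ∷ 2F ∷ 4F ∷ 3F ∷ 0F ∷ []) , (π120 ∷ π021 ∷ π120 ∷ π102 ∷ π102 ∷ []))
  ∷ ((1F ∷ 2F ∷ 4F ∷ 3F ∷ 0F ∷ []) , (π021 ∷ π012 ∷ π021 ∷ π201 ∷ π012 ∷ []))
  ∷ ((1F ∷ 2F ∷ 3F ∷ 4F ∷ 0F ∷ []) , (π021 ∷ π021 ∷ π120 ∷ π102 ∷ π012 ∷ []))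
  ∷ ((1F ∷ 2F ∷ 3F ∷ 4F ∷ 0F ∷ []) , (π102 ∷ π021 ∷ π012 ∷ π021 ∷ π012 ∷ []))
  ∷ ((1F ∷ 2F ∷ 3F ∷ 4F ∷ 0F ∷ []) , (π021 ∷ π102 ∷ π201 ∷ π021 ∷ π012 ∷ []))
  ∷ []


classification₂ : Classification 2 4 reps₂
classification₂ = classification-by-search reps₂ {certs = certs₂} refl

classification₃ : Classification 3 5 reps₃
classification₃ = extend-classification {certs = certs₃} classification₂ refl

classification₄ : Classification 4 7 reps₄
classification₄ = extend-classification {certs = certs₄} classification₃ refl

classification₅ : Classification 5 10 reps₅
classification₅ = extend-classification {certs = certs₅} classification₄ refl

no-code₅ : Classification 5 11 []
no-code₅ = extend-classification {certs = []} classification₄ refl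

no-code₆ : Classification 6 14 []
no-code₆ = extend-classification {certs = []} classification₅ refl

code₅ : List (Word 5)
code₅ =
  (0F ∷ 0F ∷ 1F ∷ 2F ∷ 2F ∷ [])
  ∷ (0F ∷ 1F ∷ 2F ∷ 1F ∷ 2F ∷ [])
  ∷ (0F ∷ 2F ∷ 0F ∷ 0F ∷ 2F ∷ [])
  ∷ (1F ∷ 0F ∷ 0F ∷ 1F ∷ 2F ∷ [])
  ∷ (1F ∷ 1F ∷ 1F ∷ 0F ∷ 0F ∷ [])
  ∷ (1F ∷ 1F ∷ 1F ∷ 0F ∷ 1F ∷ [])
  ∷ (1F ∷ 2F ∷ 2F ∷ 2F ∷ 2F ∷ [])
  ∷ (2F ∷ 0F ∷ 2F ∷ 0F ∷ 2F ∷ [])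
  ∷ (2F ∷ 1F ∷ 0F ∷ 2F ∷ 2F ∷ [])
  ∷ (2F ∷ 2F ∷ 1F ∷ 1F ∷ 2F ∷ [])
  ∷ []

code₆ : List (Word 6)
code₆ =
  (1F ∷ 0F ∷ 0F ∷ 2F ∷ 2F ∷ 1F ∷ [])
  ∷ (2F ∷ 0F ∷ 1F ∷ 1F ∷ 0F ∷ 2F ∷ [])
  ∷ (1F ∷ 1F ∷ 0F ∷ 0F ∷ 0F ∷ 1F ∷ [])
  ∷ (2F ∷ 1F ∷ 0F ∷ 2F ∷ 1F ∷ 1F ∷ [])
  ∷ (1F ∷ 1F ∷ 1F ∷ 1F ∷ 0F ∷ 0F ∷ [])
  ∷ (2F ∷ 1F ∷ 2F ∷ 1F ∷ 0F ∷ 1F ∷ [])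
  ∷ (2F ∷ 2F ∷ 0F ∷ 2F ∷ 2F ∷ 0F ∷ [])
  ∷ (2F ∷ 2F ∷ 1F ∷ 0F ∷ 2F ∷ 2F ∷ [])
  ∷ (1F ∷ 2F ∷ 1F ∷ 1F ∷ 1F ∷ 2F ∷ [])
  ∷ (1F ∷ 2F ∷ 2F ∷ 2F ∷ 2F ∷ 2F ∷ [])
  ∷ (0F ∷ 0F ∷ 2F ∷ 0F ∷ 1F ∷ 0F ∷ [])
  ∷ (0F ∷ 1F ∷ 0F ∷ 1F ∷ 2F ∷ 2F ∷ [])
  ∷ (0F ∷ 2F ∷ 1F ∷ 2F ∷ 0F ∷ 1F ∷ [])
  ∷ []

theorem1 : IsMaxTrifferentSize 5 10 × IsMaxTrifferentSize 6 13
theorem1 =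
    ( (code₅ , from-yes (unique? code₅) , from-yes (trifferent? code₅) , refl)
    , bound-from-empty-classification no-code₅ )
  , ( (code₆ , from-yes (unique? code₆) , from-yes (trifferent? code₆) , refl)
    , bound-from-empty-classification no-code₆ )
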